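{- Let $d\geq n$ be positive integers, let $H_1,\ldots,H_q\subseteq[d]$ and positive integers $r_1,\ldots,r_q$ satisfy $|H_i\cap H_j|\leq r_i+r_j-n$ for all $i\neq j$, and $|[d]\setminus H_i|\geq n-r_i$, $r_i\leq n-1$, $|H_i|\geq r_i+1$ for all $i$. Let $M$ be the elementary split matroid of $\mathcal{H}=\{H_1,\ldots,H_q\}$. Then $$\dim_{\mathrm{naive}}(\Gamma_M)=nd-\mathrm{ec}(M)=nd-\sum_{i=1}^q(n-r_i)(|H_i|-r_i).$$
   Context: The elementary split matroid of $\mathcal{H}$ is the rank-$n$ matroid on $[d]$ with independent sets $\{X\subseteq[d]:|X|\leq n,\ |X\cap H_i|\leq r_i\ \forall i\}$. Subspaces of a rank-$n$ matroid: circuits of size at most $n$ are grouped by $C_1\sim C_2\iff\mathrm{cl}(C_1)=\mathrm{cl}(C_2)$; each class $l$ is a subspace, $\mathrm{rank}(l)$ the rank of its circuits, $l$ identified with the set of points lying in some circuit of the class, $|l|$ its cardinality; $\mathcal{L}_M$ the set of subspaces. Naive dimension: $\dim_{\mathrm{naive}}(\Gamma_M)=nd-\sum_{l\in\mathcal{L}_M}(|l|-\mathrm{rank}(l))(n-\mathrm{rank}(l))$. Expected codimension: for $S\subseteq[d]$ let $c(S)=|S|-\mathrm{rank}(S)$; for a family $\mathcal{G}$ of subsets define $a_{\mathcal{G}}(\emptyset)=0$, $a_{\mathcal{G}}(S)=c(S)-\sum_{T\in\mathcal{G},T\subsetneq S}a_{\mathcal{G}}(T)$, $\mathrm{ec}_{\mathcal{G}}(M)=\sum_{S\in\mathcal{G}}(n-\mathrm{rank}(S))a_{\mathcal{G}}(S)$,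 and $\mathrm{ec}(M)=\mathrm{ec}_{\mathcal{G}}(M)$ for $\mathcal{G}$ the family of all subsets of $[d]$. -}

module Defs where

open import Data.Bool using (Bool; true; false; _∧_; _∨_; not; if_then_else_)
import Data.Bool.Properties as BP
import Data.Bool
open import Data.Nat as ℕ using (ℕ; zero; suc; _∸_; _⊔_)
import Data.Nat.Properties as NP
open import Data.Integer as ℤ using (ℤ; +_)
open import Data.Fin using (Fin)
open import Data.Fin.Subset using (Subset; ∣_∣; _∩_; _─_; _-_; ⁅_⁆; _∪_)
open import Data.List using (List; []; _∷_; _++_; map; filter; foldr; allFin)
open import Data.Bool.ListAction using (any; all)
open import Data.Vec using (Vec; []; _∷_; lookup; tabulate)
open import Data.Vec.Properties using (≡-dec)
open import Relation.Nullary.Decidable using (⌊_⌋)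

allSubsets : ∀ d → List (Subset d)
allSubsets zero    = [] ∷ []
allSubsets (suc d) = map (false ∷_) (allSubsets d) ++ map (true ∷_) (allSubsets d)

_=ℕ_ : ℕ → ℕ → Bool
m =ℕ n = ⌊ m NP.≟ n ⌋

_≤ᵇ_ : ℕ → ℕ → Bool
m ≤ᵇ n = ⌊ m NP.≤? n ⌋

_=S_ : ∀ {d} → Subset d → Subset d → Bool
S =S T = ⌊ ≡-dec BP._≟_ S T ⌋

_⊆ᵇ_ : ∀ {d} → Subset d → Subset d → Bool
_⊆ᵇ_ {d} T S = all (λ x → not (lookup T x) ∨ lookup S x) (allFin d)

_⊊ᵇ_ : ∀ {d} → Subset d → Subset d → Bool
T ⊊ᵇ S = (T ⊆ᵇ S) ∧ not (T =S S)

maxℕ : List ℕ → ℕ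
maxℕ = foldr _⊔_ 0

sumℤ : List ℤ → ℤ
sumℤ = foldr ℤ._+_ (+ 0)

-- A matroid on [d] given by its independence predicate (decidable),
-- of rank n.  All notions below are defined from the independent sets.

module MatroidNotions (n : ℕ) {d : ℕ} (indep : Subset d → Bool) where

  rank : Subset d → ℕ
  rank S = maxℕ (map ∣_∣ (filter (λ X → Data.Bool._≟_ ((X ⊆ᵇ S) ∧ indep X) true) (allSubsets d)))

  isCircuit : Subset d → Bool
  isCircuit C = not (indep C) ∧ all (λ x → not (lookup C x) ∨ indep (C - x)) (allFin d)

  cl : Subset d → Subset d
  cl S = tabulate (λ x → rank (S ∪ ⁅ x ⁆) =ℕ rank S)

  inClass : Subset d → Subset d → Bool
  inClass F C = isCircuit C ∧ (∣ C ∣ ≤ᵇ n) ∧ (cl C =S F)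

  -- The subspaces (classes of circuits of size ≤ n under C₁ ~ C₂ ⇔ cl C₁ = cl C₂)
  -- are indexed by the common closure F of their circuits.
  subspaceClosures : List (Subset d)
  subspaceClosures = filter (λ F → Data.Bool._≟_ (any (inClass F) (allSubsets d)) true) (allSubsets d)

  points : Subset d → Subset d
  points F = tabulate (λ x → any (λ C → inClass F C ∧ lookup C x) (allSubsets d))

  -- rank of the subspace = rank of its circuits = rank of their common closure F
  rankL : Subset d → ℕ
  rankL F = rank F

  naiveDim : ℤ
  naiveDim = + (n ℕ.* d) ℤ.- sumℤ (map (λ F → (+ ∣ points F ∣ ℤ.- + rankL F) ℤ.* (+ n ℤ.- + rankL F)) subspaceClosures)

  c : Subset d → ℤ
  c S = + ∣ S ∣ ℤ.- + rank S

  -- a(S) for the family of all subsets, computed with fuel k ≥ |S|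
  aFuel : ℕ → Subset d → ℤ
  aFuel zero    S = + 0
  aFuel (suc k) S = c S ℤ.- sumℤ (map (aFuel k) (filter (λ T → Data.Bool._≟_ (T ⊊ᵇ S) true) (allSubsets d)))

  a : Subset d → ℤ
  a S = aFuel ∣ S ∣ S

  ec : ℤ
  ec = sumℤ (map (λ S → (+ n ℤ.- + rank S) ℤ.* a S) (allSubsets d))

splitIndep : (n : ℕ) {d q : ℕ} → (Fin q → Subset d) → (Fin q → ℕ) → Subset d → Bool
splitIndep n {d} {q} H r X = (∣ X ∣ ≤ᵇ n) ∧ all (λ i → ∣ X ∩ H i ∣ ≤ᵇ r i) (allFin q)

-- Under the overlap bound, the circuits of size at most n are exactly the (r i + 1)-subsets of the H i;
-- each spans H i and has rank r i, so the subspaces are H 1, …, H q, with |l| = |H i| and rank r i.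
-- For the expected codimension: if rank S < n, a maximal independent X ⊆ S is tight
-- (|X ∩ H k| = r k) on at most one H k, and every point of S outside X lies in that H k, whence
-- c(S) = Σ i max(0, |S ∩ H i| − r i).  Möbius inversion is linear; the inversion of the i-th term
-- lives on subsets of H i with more than r i elements, all of rank r i, and sums to |H i| − r i
-- over them.  The inversion of the remaining part of c vanishes below full rank, and at full rank
-- the weight n − rank S vanishes.

module Submission where

open import Defs
open import Data.Nat using (ℕ; _≤_; _≥_; _<_; _+_; _*_)
open import Data.Integer as ℤ using (ℤ; +_)
open import Data.Fin using (Fin)
open import Data.Fin.Subset using (Subset; ∣_∣; _∩_; ∁)
open import Data.List using (map; allFin)
open import Data.Product using (_×_)
open import Relation.Binary.PropositionalEquality using (_≡_; _≢_)

open import Data.Bool using (Bool; true; false; not; _∧_; _∨_; if_then_else_)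
open import Data.Bool.Properties using (T-≡)
open import Data.Bool.ListAction using (any; all)
open import Data.Empty using (⊥-elim)
import Data.Fin.Properties as Fin
open import Data.Fin.Subset using (_∈_; _∉_; _⊆_; _⊂_; _∪_; _─_; _-_; ⁅_⁆; ⊥; Empty; inside; outside)
open import Data.Fin.Subset.Properties
  using (_∈?_; _⊆?_; ⊆-refl; ⊆-reflexive; ⊆-trans; ⊆-antisym; ⊥⊆; ∣⊥∣≡0; p⊆q⇒∣p∣≤∣q∣; p⊂q⇒∣p∣<∣q∣;
         Empty-unique; nonempty?; x∈p∩q⁺; x∈p∩q⁻; p∩q⊆p; p∩q⊆q; x∈p∪q⁺; x∈p∪q⁻; p⊆p∪q; q⊆p∪q;
         x∈⁅x⁆; x∈⁅y⁆⇒x≡y; p─q⊆p; x∈p∧x∉q⇒x∈p─q; x∈p∧x≢y⇒x∈p-y; x∈p⇒∣p-x∣<∣p∣; ∣⁅x⁆∣≡1;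
         ∩-comm; ∩-idem; ∩-assoc; s⊆s)
import Data.Integer.Properties as ℤ
open import Data.Integer.Tactic.RingSolver using (solve-∀)
open import Data.List using (List; []; _∷_; filter)
open import Data.List.Membership.Propositional using (find; lose) renaming (_∈_ to _∈ˡ_)
open import Data.List.Membership.Propositional.Properties
  using (∈-map⁺; ∈-map⁻; ∈-filter⁺; ∈-filter⁻; ∈-++⁺ˡ; ∈-++⁺ʳ; ∈-allFin)
open import Data.List.Relation.Unary.All as All using (All; []; _∷_)
open import Data.List.Relation.Unary.All.Properties using (all⁺; all⁻)
open import Data.List.Relation.Unary.AllPairs using ([]; _∷_)
open import Data.List.Relation.Unary.Any as Any using ()
open import Data.List.Relation.Unary.Any.Properties using (any⁺; any⁻)
open import Data.List.Relation.Unary.Unique.Propositional using (Unique)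
import Data.List.Relation.Unary.Unique.Propositional.Properties as Unique
open import Data.Nat using (zero; suc; _∸_; z≤n; s≤s)
import Data.Nat.Properties as ℕ
open import Data.Product using (∃; _,_; proj₁; proj₂)
open import Data.Sum using (_⊎_; inj₁; inj₂; [_,_]′)
open import Data.Unit using (⊤; tt)
open import Data.Vec using (_∷_; []; lookup; tabulate; here; there)
open import Data.Vec.Properties using ([]=⇒lookup; lookup⇒[]=; ∷-injectiveʳ; ≡-dec; lookup∘tabulate)
open import Function using (_∘_; case_of_)
open import Function.Bundles using (Equivalence)
open import Relation.Binary.PropositionalEquality using (refl; sym; trans; cong; cong₂; subst; module ≡-Reasoning)
open import Relation.Nullary using (¬_; yes; no; contradiction)
open import Relation.Nullary.Decidable using (Dec; ⌊_⌋; toWitness; isYes≗does; dec-true; dec-false; _→-dec_)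

private variable
  A B : Set

∑ : (A → ℤ) → List A → ℤ
∑ f xs = sumℤ (map f xs)

∑-cong : {f g : A → ℤ} → (∀ x → f x ≡ g x) → (xs : List A) → ∑ f xs ≡ ∑ g xs
∑-cong f≗g []       = refl
∑-cong f≗g (x ∷ xs) = cong₂ ℤ._+_ (f≗g x) (∑-cong f≗g xs)

∑-vanishes : {f : A → ℤ} (xs : List A) → All (λ x → f x ≡ + 0) xs → ∑ f xs ≡ + 0
∑-vanishes []       []          = refl
∑-vanishes (x ∷ xs) (fx≡0 ∷ f0) = cong₂ ℤ._+_ fx≡0 (∑-vanishes xs f0)

∑-zero : (xs : List A) → ∑ (λ _ → + 0) xs ≡ + 0
∑-zero xs = ∑-vanishes xs (All.universal (λ _ → refl) xs)

∑-+ : (f g : A → ℤ) (xs : List A) → ∑ (λ x → f x ℤ.+ g x) xs ≡ ∑ f xs ℤ.+ ∑ g xs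
∑-+ f g []       = refl
∑-+ f g (x ∷ xs) = trans (cong (ℤ._+_ (f x ℤ.+ g x)) (∑-+ f g xs)) (interchange (f x) (g x) _ _)
  where
  interchange : ∀ a b c e → a ℤ.+ b ℤ.+ (c ℤ.+ e) ≡ a ℤ.+ c ℤ.+ (b ℤ.+ e)
  interchange = solve-∀

∑-*ˡ : (k : ℤ) (f : A → ℤ) (xs : List A) → ∑ (λ x → k ℤ.* f x) xs ≡ k ℤ.* ∑ f xs
∑-*ˡ k f []       = sym (ℤ.*-zeroʳ k)
∑-*ˡ k f (x ∷ xs) = trans (cong (ℤ._+_ (k ℤ.* f x)) (∑-*ˡ k f xs)) (sym (ℤ.*-distribˡ-+ k (f x) _))

∑-swap : (f : A → B → ℤ) (xs : List A) (ys : List B) →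
         ∑ (λ x → ∑ (f x) ys) xs ≡ ∑ (λ y → ∑ (λ x → f x y) xs) ys
∑-swap f []       ys = sym (∑-zero ys)
∑-swap f (x ∷ xs) ys =
  trans (cong (ℤ._+_ (∑ (f x) ys)) (∑-swap f xs ys)) (sym (∑-+ (f x) (λ y → ∑ (λ x → f x y) xs) ys))

∑-filter : (p : A → Bool) (f : A → ℤ) (xs : List A) →
           ∑ f (filter (λ x → p x Data.Bool.≟ true) xs) ≡ ∑ (λ x → if p x then f x else + 0) xs
∑-filter p f []       = refl
∑-filter p f (x ∷ xs) with p x
... | true  = cong (ℤ._+_ (f x)) (∑-filter p f xs)
... | false = trans (∑-filter p f xs) (sym (ℤ.+-identityˡ _))

∑-delta : {f : A → ℤ} {y : A} (xs : List A) → Unique xs → y ∈ˡ xs →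
          (∀ x → x ≢ y → f x ≡ + 0) → ∑ f xs ≡ f y
∑-delta {f = f} (x ∷ xs) (x∉xs ∷ _) (Any.here refl) f0 =
  trans (cong (ℤ._+_ (f x)) (∑-vanishes xs (All.map (λ x≢y → f0 _ (x≢y ∘ sym)) x∉xs))) (ℤ.+-identityʳ (f x))
∑-delta (x ∷ xs) (x∉xs ∷ u) (Any.there y∈xs) f0 =
  trans (cong₂ ℤ._+_ (f0 x (All.lookup x∉xs y∈xs)) (∑-delta xs u y∈xs f0)) (ℤ.+-identityˡ _)

+[m+n]-+n≡+m : ∀ m n → + (m + n) ℤ.- + n ≡ + m
+[m+n]-+n≡+m m n = trans (cong (ℤ._- + n) (ℤ.pos-+ m n)) (cancel (+ m) (+ n))
  where
  cancel : ∀ a b → a ℤ.+ b ℤ.- b ≡ a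
  cancel = solve-∀

+m-+n≡+[m∸n] : ∀ {m n} → n ≤ m → + m ℤ.- + n ≡ + (m ∸ n)
+m-+n≡+[m∸n] {m} {n} n≤m = trans (ℤ.[+m]-[+n]≡m⊖n m n) (ℤ.⊖-≥ n≤m)

≤-maxℕ : {x : ℕ} (xs : List ℕ) → x ∈ˡ xs → x ≤ maxℕ xs
≤-maxℕ (x ∷ xs) (Any.here refl)  = ℕ.m≤m⊔n x _
≤-maxℕ (y ∷ xs) (Any.there x∈xs) = ℕ.≤-trans (≤-maxℕ xs x∈xs) (ℕ.m≤n⊔m y _)

maxℕ-attained : (xs : List ℕ) → maxℕ xs ≡ 0 ⊎ maxℕ xs ∈ˡ xs
maxℕ-attained [] = inj₁ refl
maxℕ-attained (y ∷ xs) with ℕ.⊔-sel y (maxℕ xs) | maxℕ-attained xs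
... | inj₁ max≡y  | _          = inj₂ (Any.here max≡y)
... | inj₂ max≡m  | inj₁ m≡0   = inj₁ (trans max≡m m≡0)
... | inj₂ max≡m  | inj₂ m∈xs  = inj₂ (Any.there (subst (_∈ˡ xs) (sym max≡m) m∈xs))

yes⇒ : {P : Set} (p? : Dec P) → ⌊ p? ⌋ ≡ true → P
yes⇒ p? e = toWitness (Equivalence.from T-≡ e)

⇒yes : {P : Set} (p? : Dec P) → P → ⌊ p? ⌋ ≡ true
⇒yes p? p = trans (isYes≗does p?) (dec-true p? p)

⇒no : {P : Set} (p? : Dec P) → ¬ P → ⌊ p? ⌋ ≡ false
⇒no p? ¬p = trans (isYes≗does p?) (dec-false p? ¬p)

∧-true⇒ : {a b : Bool} → (a ∧ b) ≡ true → a ≡ true × b ≡ true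
∧-true⇒ {true} {true} _ = refl , refl

all-allFin⇒ : {q : ℕ} (p : Fin q → Bool) → all p (allFin q) ≡ true → ∀ i → p i ≡ true
all-allFin⇒ p e i = Equivalence.to T-≡ (All.lookup (all⁺ p _ (Equivalence.from T-≡ e)) (∈-allFin i))

⇒all-allFin : {q : ℕ} (p : Fin q → Bool) → (∀ i → p i ≡ true) → all p (allFin q) ≡ true
⇒all-allFin p h = Equivalence.to T-≡ (all⁻ p {xs = allFin _} (All.tabulate (λ {i} _ → Equivalence.from T-≡ (h i))))

any⇒ : (p : A → Bool) (xs : List A) → any p xs ≡ true → ∃ λ x → x ∈ˡ xs × p x ≡ true
any⇒ p xs e = let x , x∈xs , px = find (any⁻ p xs (Equivalence.from T-≡ e)) in x , x∈xs , Equivalence.to T-≡ px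

⇒any : (p : A → Bool) {xs : List A} {x : A} → x ∈ˡ xs → p x ≡ true → any p xs ≡ true
⇒any p x∈xs px = Equivalence.to T-≡ (any⁺ p (lose x∈xs (Equivalence.from T-≡ px)))

module _ {d : ℕ} where

  ∈⇒lookup : {p : Subset d} {x : Fin d} → x ∈ p → lookup p x ≡ true
  ∈⇒lookup = []=⇒lookup

  lookup⇒∈ : {p : Subset d} {x : Fin d} → lookup p x ≡ true → x ∈ p
  lookup⇒∈ {p} {x} = lookup⇒[]= x p

  ⊆ᵇ⇒⊆ : {p q : Subset d} → (p ⊆ᵇ q) ≡ true → p ⊆ q
  ⊆ᵇ⇒⊆ {p} {q} e {x} x∈p =
    lookup⇒∈ (subst (λ b → (not b ∨ lookup q x) ≡ true) (∈⇒lookup x∈p) (all-allFin⇒ _ e x))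

  ⊆⇒⊆ᵇ : {p q : Subset d} → p ⊆ q → (p ⊆ᵇ q) ≡ true
  ⊆⇒⊆ᵇ {p} {q} p⊆q = ⇒all-allFin _ pointwise
    where
    pointwise : ∀ x → (not (lookup p x) ∨ lookup q x) ≡ true
    pointwise x with lookup p x in px
    ... | false = refl
    ... | true  = ∈⇒lookup (p⊆q (lookup⇒∈ px))

  =S⇒≡ : {p q : Subset d} → (p =S q) ≡ true → p ≡ q
  =S⇒≡ {p} {q} = yes⇒ (≡-dec Data.Bool.Properties._≟_ p q)

  ≡⇒=S : {p q : Subset d} → p ≡ q → (p =S q) ≡ true
  ≡⇒=S {p} {q} = ⇒yes (≡-dec Data.Bool.Properties._≟_ p q)

  ≢⇒=S : {p q : Subset d} → p ≢ q → (p =S q) ≡ false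
  ≢⇒=S {p} {q} = ⇒no (≡-dec Data.Bool.Properties._≟_ p q)

  ⊈⇒∃∉ : {p q : Subset d} → ¬ p ⊆ q → ∃ λ x → x ∈ p × x ∉ q
  ⊈⇒∃∉ {p} {q} p⊈q with Fin.¬∀⟶∃¬ d (λ x → x ∈ p → x ∈ q) (λ x → (x ∈? p) →-dec (x ∈? q)) (λ p⊆q → p⊈q (p⊆q _))
  ... | x , p⇏q with x ∈? p
  ...   | yes x∈p = x , x∈p , (λ x∈q → p⇏q (λ _ → x∈q))
  ...   | no  x∉p = contradiction (λ x∈p → contradiction x∈p x∉p) p⇏q

  ⊆∧≢⇒⊂ : {p q : Subset d} → p ⊆ q → p ≢ q → p ⊂ q
  ⊆∧≢⇒⊂ {p} {q} p⊆q p≢q = p⊆q , ⊈⇒∃∉ {q} {p} (λ q⊆p → p≢q (⊆-antisym p⊆q q⊆p))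

  ⊊ᵇ⇒⊂ : {p q : Subset d} → (p ⊊ᵇ q) ≡ true → p ⊂ q
  ⊊ᵇ⇒⊂ {p} {q} e with p ⊆ᵇ q in p⊆ᵇq | p =S q in p=q
  ... | true | false = ⊆∧≢⇒⊂ (⊆ᵇ⇒⊆ p⊆ᵇq) (λ p≡q → case trans (sym (≡⇒=S p≡q)) p=q of λ ())

  ⊂⇒⊊ᵇ : {p q : Subset d} → p ⊂ q → (p ⊊ᵇ q) ≡ true
  ⊂⇒⊊ᵇ (p⊆q , x , x∈q , x∉p) =
    cong₂ (λ a b → a ∧ not b) (⊆⇒⊆ᵇ p⊆q) (≢⇒=S (λ { refl → x∉p x∈q }))

∈-allSubsets : {d : ℕ} (p : Subset d) → p ∈ˡ allSubsets d
∈-allSubsets []                    = Any.here refl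
∈-allSubsets {suc d} (outside ∷ p) = ∈-++⁺ˡ (∈-map⁺ (outside ∷_) (∈-allSubsets p))
∈-allSubsets {suc d} (inside ∷ p)  = ∈-++⁺ʳ (map (outside ∷_) (allSubsets d)) (∈-map⁺ (inside ∷_) (∈-allSubsets p))

allSubsets-unique : (d : ℕ) → Unique (allSubsets d)
allSubsets-unique zero    = [] ∷ []
allSubsets-unique (suc d) =
  Unique.++⁺ (Unique.map⁺ ∷-injectiveʳ (allSubsets-unique d)) (Unique.map⁺ ∷-injectiveʳ (allSubsets-unique d)) heads-differ
  where
  heads-differ : ∀ {v} → ¬ (v ∈ˡ map (outside ∷_) (allSubsets d) × v ∈ˡ map (inside ∷_) (allSubsets d))
  heads-differ (v∈out , v∈in) with ∈-map⁻ _ v∈out | ∈-map⁻ _ v∈in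
  ... | _ , _ , refl | _ , _ , ()

∈-tabulate⁺ : {d : ℕ} {f : Fin d → Bool} {x : Fin d} → f x ≡ true → x ∈ tabulate f
∈-tabulate⁺ {f = f} {x} fx = lookup⇒∈ (trans (lookup∘tabulate f x) fx)

∈-tabulate⁻ : {d : ℕ} {f : Fin d → Bool} {x : Fin d} → x ∈ tabulate f → f x ≡ true
∈-tabulate⁻ {f = f} {x} x∈ = trans (sym (lookup∘tabulate f x)) (∈⇒lookup x∈)

x∈p─q⇒x∉q : {d : ℕ} {p q : Subset d} {x : Fin d} → x ∈ p ─ q → x ∉ q
x∈p─q⇒x∉q {p = inside ∷ p} {outside ∷ q} here        ()
x∈p─q⇒x∉q {p = s ∷ p}      {t ∷ q}       (there x∈) (there x∈q) = x∈p─q⇒x∉q x∈ x∈q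

⊆⇒∩≡ : {d : ℕ} {p q : Subset d} → p ⊆ q → p ∩ q ≡ p
⊆⇒∩≡ {p = p} {q} p⊆q = ⊆-antisym (p∩q⊆p p q) (λ x∈p → x∈p∩q⁺ (x∈p , p⊆q x∈p))

x∈p⇒⁅x⁆⊆p : {d : ℕ} {p : Subset d} {x : Fin d} → x ∈ p → ⁅ x ⁆ ⊆ p
x∈p⇒⁅x⁆⊆p {p = p} {x} x∈p y∈⁅x⁆ = subst (_∈ p) (sym (x∈⁅y⁆⇒x≡y x y∈⁅x⁆)) x∈p

p∪⁅x⁆⊆q : {d : ℕ} {p q : Subset d} {x : Fin d} → p ⊆ q → x ∈ q → p ∪ ⁅ x ⁆ ⊆ q
p∪⁅x⁆⊆q {p = p} {x = x} p⊆q x∈q y∈ = [ p⊆q , x∈p⇒⁅x⁆⊆p x∈q ]′ (x∈p∪q⁻ p ⁅ x ⁆ y∈)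

∩-monoˡ-⊆ : {d : ℕ} {p q : Subset d} (r : Subset d) → p ⊆ q → p ∩ r ⊆ q ∩ r
∩-monoˡ-⊆ {p = p} r p⊆q x∈ with x∈p∩q⁻ p r x∈
... | x∈p , x∈r = x∈p∩q⁺ (p⊆q x∈p , x∈r)

─-monoˡ-⊆ : {d : ℕ} {p q : Subset d} (r : Subset d) → p ⊆ q → p ─ r ⊆ q ─ r
─-monoˡ-⊆ {p = p} r p⊆q x∈ = x∈p∧x∉q⇒x∈p─q (p⊆q (p─q⊆p p r x∈)) (x∈p─q⇒x∉q x∈)

[p∪⁅x⁆]∩q⊆[p∩q]∪⁅x⁆ : {d : ℕ} (p q : Subset d) (x : Fin d) → (p ∪ ⁅ x ⁆) ∩ q ⊆ (p ∩ q) ∪ ⁅ x ⁆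
[p∪⁅x⁆]∩q⊆[p∩q]∪⁅x⁆ p q x y∈ with x∈p∩q⁻ (p ∪ ⁅ x ⁆) q y∈
... | y∈p∪x , y∈q = x∈p∪q⁺ (Data.Sum.map₁ (λ y∈p → x∈p∩q⁺ (y∈p , y∈q)) (x∈p∪q⁻ p ⁅ x ⁆ y∈p∪x))

x∉q⇒[p∪⁅x⁆]∩q⊆p∩q : {d : ℕ} (p q : Subset d) {x : Fin d} → x ∉ q → (p ∪ ⁅ x ⁆) ∩ q ⊆ p ∩ q
x∉q⇒[p∪⁅x⁆]∩q⊆p∩q p q {x} x∉q y∈ with x∈p∪q⁻ _ _ ([p∪⁅x⁆]∩q⊆[p∩q]∪⁅x⁆ p q x y∈)
... | inj₁ y∈p∩q = y∈p∩q
... | inj₂ y∈⁅x⁆ = ⊥-elim (x∉q (subst (_∈ q) (x∈⁅y⁆⇒x≡y x y∈⁅x⁆) (proj₂ (x∈p∩q⁻ _ q y∈))))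

∣p∩q∣+∣p∪q∣≡∣p∣+∣q∣ : {d : ℕ} (p q : Subset d) → ∣ p ∩ q ∣ + ∣ p ∪ q ∣ ≡ ∣ p ∣ + ∣ q ∣
∣p∩q∣+∣p∪q∣≡∣p∣+∣q∣ []            []            = refl
∣p∩q∣+∣p∪q∣≡∣p∣+∣q∣ (outside ∷ p) (outside ∷ q) = ∣p∩q∣+∣p∪q∣≡∣p∣+∣q∣ p q
∣p∩q∣+∣p∪q∣≡∣p∣+∣q∣ (outside ∷ p) (inside ∷ q)  =
  trans (ℕ.+-suc _ _) (trans (cong suc (∣p∩q∣+∣p∪q∣≡∣p∣+∣q∣ p q)) (sym (ℕ.+-suc _ _)))
∣p∩q∣+∣p∪q∣≡∣p∣+∣q∣ (inside ∷ p)  (outside ∷ q) = trans (ℕ.+-suc _ _) (cong suc (∣p∩q∣+∣p∪q∣≡∣p∣+∣q∣ p q))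
∣p∩q∣+∣p∪q∣≡∣p∣+∣q∣ (inside ∷ p)  (inside ∷ q)  =
  cong suc (trans (ℕ.+-suc _ _) (trans (cong suc (∣p∩q∣+∣p∪q∣≡∣p∣+∣q∣ p q)) (sym (ℕ.+-suc _ _))))

∣p∣+∣q∣≤∣u∣+∣v∣ : {d : ℕ} (p q u v : Subset d) → p ∩ q ⊆ u ∩ v → p ∪ q ⊆ u ∪ v → ∣ p ∣ + ∣ q ∣ ≤ ∣ u ∣ + ∣ v ∣
∣p∣+∣q∣≤∣u∣+∣v∣ p q u v ∩⊆ ∪⊆ = begin
  ∣ p ∣ + ∣ q ∣          ≡⟨ ∣p∩q∣+∣p∪q∣≡∣p∣+∣q∣ p q ⟨
  ∣ p ∩ q ∣ + ∣ p ∪ q ∣  ≤⟨ ℕ.+-mono-≤ (p⊆q⇒∣p∣≤∣q∣ ∩⊆) (p⊆q⇒∣p∣≤∣q∣ ∪⊆) ⟩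
  ∣ u ∩ v ∣ + ∣ u ∪ v ∣  ≡⟨ ∣p∩q∣+∣p∪q∣≡∣p∣+∣q∣ u v ⟩
  ∣ u ∣ + ∣ v ∣          ∎
  where open ℕ.≤-Reasoning

Empty⇒∣p∣≡0 : {d : ℕ} {p : Subset d} → Empty p → ∣ p ∣ ≡ 0
Empty⇒∣p∣≡0 {d} empty = trans (cong ∣_∣ (Empty-unique empty)) (∣⊥∣≡0 d)

∣p∪q∣≤∣p∣+∣q∣ : {d : ℕ} (p q : Subset d) → ∣ p ∪ q ∣ ≤ ∣ p ∣ + ∣ q ∣
∣p∪q∣≤∣p∣+∣q∣ p q = subst (∣ p ∪ q ∣ ≤_) (∣p∩q∣+∣p∪q∣≡∣p∣+∣q∣ p q) (ℕ.m≤n+m _ _)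

∣p∣≡∣p∩q∣+∣p─q∣ : {d : ℕ} (p q : Subset d) → ∣ p ∣ ≡ ∣ p ∩ q ∣ + ∣ p ─ q ∣
∣p∣≡∣p∩q∣+∣p─q∣ p q = begin
  ∣ p ∣                                       ≡⟨ cong ∣_∣ union ⟨
  ∣ (p ∩ q) ∪ (p ─ q) ∣                       ≡⟨ cong (λ k → k + ∣ (p ∩ q) ∪ (p ─ q) ∣) (Empty⇒∣p∣≡0 disjoint) ⟨
  ∣ (p ∩ q) ∩ (p ─ q) ∣ + ∣ (p ∩ q) ∪ (p ─ q) ∣ ≡⟨ ∣p∩q∣+∣p∪q∣≡∣p∣+∣q∣ (p ∩ q) (p ─ q) ⟩
  ∣ p ∩ q ∣ + ∣ p ─ q ∣                       ∎
  where
  open ≡-Reasoning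
  disjoint : Empty ((p ∩ q) ∩ (p ─ q))
  disjoint (x , x∈) = x∈p─q⇒x∉q (proj₂ (x∈p∩q⁻ _ _ x∈)) (proj₂ (x∈p∩q⁻ _ _ (proj₁ (x∈p∩q⁻ _ _ x∈))))
  split : ∀ {x} → x ∈ p → x ∈ (p ∩ q) ∪ (p ─ q)
  split {x} x∈p with x ∈? q
  ... | yes x∈q = x∈p∪q⁺ (inj₁ (x∈p∩q⁺ (x∈p , x∈q)))
  ... | no  x∉q = x∈p∪q⁺ (inj₂ (x∈p∧x∉q⇒x∈p─q x∈p x∉q))
  union : (p ∩ q) ∪ (p ─ q) ≡ p
  union = ⊆-antisym (λ x∈ → [ proj₁ ∘ x∈p∩q⁻ p q , p─q⊆p p q ]′ (x∈p∪q⁻ _ _ x∈)) split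

∣p∪⁅x⁆∣≡1+∣p∣ : {d : ℕ} {p : Subset d} {x : Fin d} → x ∉ p → ∣ p ∪ ⁅ x ⁆ ∣ ≡ suc ∣ p ∣
∣p∪⁅x⁆∣≡1+∣p∣ {p = p} {x} x∉p = begin
  (∣ p ∪ ⁅ x ⁆ ∣)                   ≡⟨ cong (λ k → k + (∣ p ∪ ⁅ x ⁆ ∣)) (Empty⇒∣p∣≡0 disjoint) ⟨
  (∣ p ∩ ⁅ x ⁆ ∣) + (∣ p ∪ ⁅ x ⁆ ∣)   ≡⟨ ∣p∩q∣+∣p∪q∣≡∣p∣+∣q∣ p ⁅ x ⁆ ⟩
  (∣ p ∣) + (∣ ⁅ x ⁆ ∣)               ≡⟨ ℕ.+-comm (∣ p ∣) _ ⟩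
  (∣ ⁅ x ⁆ ∣) + (∣ p ∣)               ≡⟨ cong (λ k → k + ∣ p ∣) (∣⁅x⁆∣≡1 x) ⟩
  suc (∣ p ∣)                       ∎
  where
  open ≡-Reasoning
  disjoint : Empty (p ∩ ⁅ x ⁆)
  disjoint (y , y∈) with x∈p∩q⁻ p ⁅ x ⁆ y∈
  ... | y∈p , y∈⁅x⁆ = x∉p (subst (_∈ p) (x∈⁅y⁆⇒x≡y x y∈⁅x⁆) y∈p)

∣p∪⁅x⁆∣≤1+∣p∣ : {d : ℕ} (p : Subset d) (x : Fin d) → ∣ p ∪ ⁅ x ⁆ ∣ ≤ suc ∣ p ∣
∣p∪⁅x⁆∣≤1+∣p∣ p x = ℕ.≤-trans (∣p∪q∣≤∣p∣+∣q∣ p ⁅ x ⁆)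
  (ℕ.≤-reflexive (trans (cong (λ m → ∣ p ∣ + m) (∣⁅x⁆∣≡1 x)) (ℕ.+-comm ∣ p ∣ 1)))

1+∣p-x∣≡∣p∣ : {d : ℕ} {p : Subset d} {x : Fin d} → x ∈ p → suc ∣ p - x ∣ ≡ ∣ p ∣
1+∣p-x∣≡∣p∣ {p = p} {x} x∈p = sym (begin
  (∣ p ∣)                       ≡⟨ ∣p∣≡∣p∩q∣+∣p─q∣ p ⁅ x ⁆ ⟩
  (∣ p ∩ ⁅ x ⁆ ∣) + (∣ p - x ∣)   ≡⟨ cong (λ s → ∣ s ∣ + ∣ p - x ∣) (trans (∩-comm p ⁅ x ⁆) (⊆⇒∩≡ (x∈p⇒⁅x⁆⊆p x∈p))) ⟩
  (∣ ⁅ x ⁆ ∣) + (∣ p - x ∣)       ≡⟨ cong (λ k → k + ∣ p - x ∣) (∣⁅x⁆∣≡1 x) ⟩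
  suc (∣ p - x ∣)               ∎)
  where open ≡-Reasoning

∣p∣≡0⇒p≡⊥ : {d : ℕ} {p : Subset d} → ∣ p ∣ ≡ 0 → p ≡ ⊥
∣p∣≡0⇒p≡⊥ {p = p} ∣p∣≡0 = Empty-unique λ (x , x∈p) → ℕ.n≮0 (subst (λ k → ∣ p - x ∣ < k) ∣p∣≡0 (x∈p⇒∣p-x∣<∣p∣ x∈p))

1≤∣p∣⇒nonempty : {d : ℕ} {p : Subset d} → 1 ≤ ∣ p ∣ → ∃ λ x → x ∈ p
1≤∣p∣⇒nonempty {d} {p} 1≤∣p∣ with nonempty? p
... | yes ne  = ne
... | no  ¬ne = case subst (1 ≤_) (∣⊥∣≡0 d) (subst (λ q → 1 ≤ ∣ q ∣) (Empty-unique ¬ne) 1≤∣p∣) of λ ()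

⊆-ofSize : {d k : ℕ} (p : Subset d) → k ≤ ∣ p ∣ → ∃ λ q → q ⊆ p × ∣ q ∣ ≡ k
⊆-ofSize {d} {zero}  p             _         = ⊥ , ⊥⊆ , ∣⊥∣≡0 d
⊆-ofSize {k = suc k} (inside ∷ p)  (s≤s k≤p) with ⊆-ofSize p k≤p
... | q , q⊆p , ∣q∣≡k = inside ∷ q , s⊆s q⊆p , cong suc ∣q∣≡k
⊆-ofSize {k = suc k} (outside ∷ p) k<p       with ⊆-ofSize p k<p
... | q , q⊆p , ∣q∣≡k = outside ∷ q , s⊆s q⊆p , ∣q∣≡k

⊆-ofSize-∋ : {d k : ℕ} {p : Subset d} {x : Fin d} → x ∈ p → suc k ≤ ∣ p ∣ →
             ∃ λ q → q ⊆ p × x ∈ q × ∣ q ∣ ≡ suc k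
⊆-ofSize-∋ {k = k} {p} {x} x∈p k<∣p∣ with ⊆-ofSize (p - x) (ℕ.≤-pred (subst (suc k ≤_) (sym (1+∣p-x∣≡∣p∣ x∈p)) k<∣p∣))
... | q , q⊆p-x , ∣q∣≡k =
  q ∪ ⁅ x ⁆ , p∪⁅x⁆⊆q (p─q⊆p p ⁅ x ⁆ ∘ q⊆p-x) x∈p , x∈p∪q⁺ (inj₂ (x∈⁅x⁆ x)) ,
  trans (∣p∪⁅x⁆∣≡1+∣p∣ (λ x∈q → x∈p─q⇒x∉q (q⊆p-x x∈q) (x∈⁅x⁆ x))) (cong suc ∣q∣≡k)

-- Rank

module Rank (n : ℕ) {d : ℕ} (indep : Subset d → Bool) (indep-⊥ : indep ⊥ ≡ true) where

  open MatroidNotions n indep using (rank)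

  private
    independentIn? : (S X : Subset d) → Dec (((X ⊆ᵇ S) ∧ indep X) ≡ true)
    independentIn? S X = ((X ⊆ᵇ S) ∧ indep X) Data.Bool.≟ true

  ≤-rank : {X S : Subset d} → indep X ≡ true → X ⊆ S → ∣ X ∣ ≤ rank S
  ≤-rank {X} {S} iX X⊆S =
    ≤-maxℕ _ (∈-map⁺ ∣_∣ (∈-filter⁺ (independentIn? S) (∈-allSubsets X) (cong₂ _∧_ (⊆⇒⊆ᵇ X⊆S) iX)))

  rank-witness : (S : Subset d) → ∃ λ X → X ⊆ S × indep X ≡ true × ∣ X ∣ ≡ rank S
  rank-witness S with maxℕ-attained (map ∣_∣ (filter (independentIn? S) (allSubsets d)))
  ... | inj₁ rank≡0 = ⊥ , ⊥⊆ , indep-⊥ , trans (∣⊥∣≡0 d) (sym rank≡0)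
  ... | inj₂ rank∈ with ∈-map⁻ ∣_∣ rank∈
  ...   | X , X∈ , rank≡∣X∣ with ∧-true⇒ (proj₂ (∈-filter⁻ (independentIn? S) {xs = allSubsets d} X∈))
  ...     | X⊆ᵇS , iX = X , ⊆ᵇ⇒⊆ X⊆ᵇS , iX , sym rank≡∣X∣

  rank-≤ : (S : Subset d) {k : ℕ} → (∀ {X} → X ⊆ S → indep X ≡ true → ∣ X ∣ ≤ k) → rank S ≤ k
  rank-≤ S bound with rank-witness S
  ... | X , X⊆S , iX , ∣X∣≡rank = subst (_≤ _) ∣X∣≡rank (bound X⊆S iX)

  rank-mono : {P Q : Subset d} → P ⊆ Q → rank P ≤ rank Q
  rank-mono P⊆Q = rank-≤ _ (λ X⊆P iX → ≤-rank iX (⊆-trans X⊆P P⊆Q))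

-- Möbius inversion on the Boolean lattice

module _ {d : ℕ} where

  ∑ₛ : (Subset d → Bool) → (Subset d → ℤ) → ℤ
  ∑ₛ p f = ∑ (λ T → if p T then f T else + 0) (allSubsets d)

  ∑ₛ-cong : (p : Subset d → Bool) {f h : Subset d → ℤ} → (∀ T → p T ≡ true → f T ≡ h T) → ∑ₛ p f ≡ ∑ₛ p h
  ∑ₛ-cong p f≗h = ∑-cong pointwise (allSubsets d)
    where
    pointwise : ∀ T → (if p T then _ else + 0) ≡ (if p T then _ else + 0)
    pointwise T with p T in pT
    ... | true  = f≗h T pT
    ... | false = refl
  ∑ₛ-=S : (R : Subset d) (f : Subset d → ℤ) → ∑ₛ (_=S R) f ≡ f R
  ∑ₛ-=S R f = trans (∑-delta (allSubsets d) (allSubsets-unique d) (∈-allSubsets R) off-R)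
                    (cong (λ b → if b then f R else + 0) (≡⇒=S refl))
    where
    off-R : ∀ T → T ≢ R → (if T =S R then f T else + 0) ≡ + 0
    off-R T T≢R rewrite ≢⇒=S T≢R = refl

  ∑ₛ-⊆ᵇ : (R : Subset d) (f : Subset d → ℤ) → ∑ₛ (_⊆ᵇ R) f ≡ f R ℤ.+ ∑ₛ (_⊊ᵇ R) f
  ∑ₛ-⊆ᵇ R f = trans (∑-cong pointwise (allSubsets d))
                    (trans (∑-+ _ _ (allSubsets d)) (cong (ℤ._+ ∑ₛ (_⊊ᵇ R) f) (∑ₛ-=S R f)))
    where
    pointwise : ∀ T → (if T ⊆ᵇ R then f T else + 0) ≡ (if T =S R then f T else + 0) ℤ.+ (if T ⊊ᵇ R then f T else + 0)
    pointwise T with T ⊆ᵇ R in T⊆R | T =S R in T=R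
    ... | true  | true  = sym (ℤ.+-identityʳ _)
    ... | true  | false = sym (ℤ.+-identityˡ _)
    ... | false | false = refl
    ... | false | true  = case trans (sym (⊆⇒⊆ᵇ (⊆-reflexive (=S⇒≡ T=R)))) T⊆R of λ ()

  strictSubsets : Subset d → List (Subset d)
  strictSubsets S = filter (λ T → (T ⊊ᵇ S) Data.Bool.≟ true) (allSubsets d)

  -- The recursion defining `a` in `MatroidNotions`, with `c` replaced by an arbitrary g.
  möbiusFuel : (Subset d → ℤ) → ℕ → Subset d → ℤ
  möbiusFuel g zero    S = + 0
  möbiusFuel g (suc k) S = g S ℤ.- ∑ (möbiusFuel g k) (strictSubsets S)

  möbius : (Subset d → ℤ) → Subset d → ℤ
  möbius g S = möbiusFuel g ∣ S ∣ S

  möbiusFuel-suc : (g : Subset d → ℤ) (k : ℕ) (S : Subset d) →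
                   möbiusFuel g (suc k) S ≡ g S ℤ.- ∑ₛ (_⊊ᵇ S) (möbiusFuel g k)
  möbiusFuel-suc g k S = cong (λ s → g S ℤ.- s) (∑-filter (_⊊ᵇ S) (möbiusFuel g k) (allSubsets d))

  möbiusFuel-cong : {g h : Subset d → ℤ} → (∀ S → g S ≡ h S) → ∀ k S → möbiusFuel g k S ≡ möbiusFuel h k S
  möbiusFuel-cong g≗h zero    S = refl
  möbiusFuel-cong g≗h (suc k) S = cong₂ ℤ._-_ (g≗h S) (∑-cong (möbiusFuel-cong g≗h k) (strictSubsets S))

  möbiusFuel-+ : (g h : Subset d → ℤ) → ∀ k S →
                 möbiusFuel (λ T → g T ℤ.+ h T) k S ≡ möbiusFuel g k S ℤ.+ möbiusFuel h k S
  möbiusFuel-+ g h zero    S = refl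
  möbiusFuel-+ g h (suc k) S = begin
    g S ℤ.+ h S ℤ.- ∑ (möbiusFuel (λ T → g T ℤ.+ h T) k) (strictSubsets S)
      ≡⟨ cong (λ s → g S ℤ.+ h S ℤ.- s) (trans (∑-cong (möbiusFuel-+ g h k) (strictSubsets S)) (∑-+ _ _ (strictSubsets S))) ⟩
    g S ℤ.+ h S ℤ.- (∑ (möbiusFuel g k) (strictSubsets S) ℤ.+ ∑ (möbiusFuel h k) (strictSubsets S))
      ≡⟨ regroup (g S) (h S) _ _ ⟩
    möbiusFuel g (suc k) S ℤ.+ möbiusFuel h (suc k) S ∎
    where
    open ≡-Reasoning
    regroup : ∀ a b x y → a ℤ.+ b ℤ.- (x ℤ.+ y) ≡ (a ℤ.- x) ℤ.+ (b ℤ.- y)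
    regroup = solve-∀

  möbiusFuel-vanishes : (g : Subset d → ℤ) (D : Subset d → Set) → (∀ {P Q} → P ⊆ Q → D Q → D P) →
                        (∀ T → D T → g T ≡ + 0) → ∀ k S → D S → möbiusFuel g k S ≡ + 0
  möbiusFuel-vanishes g D down g0 zero    S DS = refl
  möbiusFuel-vanishes g D down g0 (suc k) S DS = trans (möbiusFuel-suc g k S) (begin
    g S ℤ.- ∑ₛ (_⊊ᵇ S) (möbiusFuel g k) ≡⟨ cong₂ ℤ._-_ (g0 S DS) (∑ₛ-cong (_⊊ᵇ S) below) ⟩
    + 0 ℤ.- ∑ₛ (_⊊ᵇ S) (λ _ → + 0)      ≡⟨ cong (λ s → + 0 ℤ.- s) (∑-vanishes (allSubsets d) (All.universal zero-if _)) ⟩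
    + 0                                  ∎)
    where
    open ≡-Reasoning
    below : ∀ T → (T ⊊ᵇ S) ≡ true → möbiusFuel g k T ≡ + 0
    below T T⊂S = möbiusFuel-vanishes g D down g0 k T (down (proj₁ (⊊ᵇ⇒⊂ T⊂S)) DS)
    zero-if : ∀ T → (if T ⊊ᵇ S then + 0 else + 0) ≡ + 0
    zero-if T with T ⊊ᵇ S
    ... | true  = refl
    ... | false = refl

  möbiusFuel-∑ : {I : Set} (g : I → Subset d → ℤ) (xs : List I) → ∀ k S →
                 möbiusFuel (λ T → ∑ (λ i → g i T) xs) k S ≡ ∑ (λ i → möbiusFuel (g i) k S) xs
  möbiusFuel-∑ g []       k S = möbiusFuel-vanishes (λ _ → + 0) (λ _ → ⊤) _ (λ _ _ → refl) k S tt
  möbiusFuel-∑ g (x ∷ xs) k S =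
    trans (möbiusFuel-+ (g x) (λ T → ∑ (λ i → g i T) xs) k S) (cong (ℤ._+_ (möbiusFuel (g x) k S)) (möbiusFuel-∑ g xs k S))

  -- Fuel 0 returns 0, so the fuel is irrelevant (and the recursion holds at S = ⊥) only when g ⊥ ≡ 0.
  module Möbius (g : Subset d → ℤ) (g⊥ : g ⊥ ≡ + 0) where

    private
      smaller : {T S : Subset d} {k : ℕ} → (T ⊊ᵇ S) ≡ true → ∣ S ∣ ≤ suc k → ∣ T ∣ ≤ k
      smaller {T} {S} T⊂S ∣S∣≤ = ℕ.≤-pred (ℕ.≤-trans (p⊂q⇒∣p∣<∣q∣ (⊊ᵇ⇒⊂ {p = T} {q = S} T⊂S)) ∣S∣≤)

      fuel-of-empty : ∀ k S → ∣ S ∣ ≡ 0 → möbiusFuel g k S ≡ + 0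
      fuel-of-empty = möbiusFuel-vanishes g (λ T → ∣ T ∣ ≡ 0)
        (λ P⊆Q ∣Q∣≡0 → ℕ.n≤0⇒n≡0 (subst (_ ≤_) ∣Q∣≡0 (p⊆q⇒∣p∣≤∣q∣ P⊆Q)))
        (λ T ∣T∣≡0 → trans (cong g (∣p∣≡0⇒p≡⊥ ∣T∣≡0)) g⊥)

    fuel-irrelevant : ∀ j k S → ∣ S ∣ ≤ j → ∣ S ∣ ≤ k → möbiusFuel g j S ≡ möbiusFuel g k S
    fuel-irrelevant zero    k       S ∣S∣≤0 _     = sym (fuel-of-empty k S (ℕ.n≤0⇒n≡0 ∣S∣≤0))
    fuel-irrelevant (suc j) zero    S _     ∣S∣≤0 = fuel-of-empty (suc j) S (ℕ.n≤0⇒n≡0 ∣S∣≤0)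
    fuel-irrelevant (suc j) (suc k) S ∣S∣≤j ∣S∣≤k = begin
      möbiusFuel g (suc j) S                ≡⟨ möbiusFuel-suc g j S ⟩
      g S ℤ.- ∑ₛ (_⊊ᵇ S) (möbiusFuel g j)  ≡⟨ cong (λ s → g S ℤ.- s) (∑ₛ-cong (_⊊ᵇ S) λ T T⊂S →
                                                 fuel-irrelevant j k T (smaller T⊂S ∣S∣≤j) (smaller T⊂S ∣S∣≤k)) ⟩
      g S ℤ.- ∑ₛ (_⊊ᵇ S) (möbiusFuel g k)  ≡⟨ möbiusFuel-suc g k S ⟨
      möbiusFuel g (suc k) S                ∎
      where open ≡-Reasoning

    möbiusFuel≡möbius : ∀ k S → ∣ S ∣ ≤ k → möbiusFuel g k S ≡ möbius g S
    möbiusFuel≡möbius k S ∣S∣≤k = fuel-irrelevant k ∣ S ∣ S ∣S∣≤k ℕ.≤-refl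

    möbius-rec : ∀ S → möbius g S ≡ g S ℤ.- ∑ₛ (_⊊ᵇ S) (möbius g)
    möbius-rec S = begin
      möbius g S                                ≡⟨ möbiusFuel≡möbius (suc ∣ S ∣) S (ℕ.n≤1+n _) ⟨
      möbiusFuel g (suc ∣ S ∣) S                ≡⟨ möbiusFuel-suc g ∣ S ∣ S ⟩
      g S ℤ.- ∑ₛ (_⊊ᵇ S) (möbiusFuel g ∣ S ∣)  ≡⟨ cong (λ s → g S ℤ.- s) (∑ₛ-cong (_⊊ᵇ S) λ T T⊂S →
                                                    möbiusFuel≡möbius ∣ S ∣ T (smaller T⊂S (ℕ.n≤1+n _))) ⟩
      g S ℤ.- ∑ₛ (_⊊ᵇ S) (möbius g)            ∎
      where open ≡-Reasoning

    ∑-möbius : ∀ R → ∑ₛ (_⊆ᵇ R) (möbius g) ≡ g R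
    ∑-möbius R = begin
      ∑ₛ (_⊆ᵇ R) (möbius g)                                          ≡⟨ ∑ₛ-⊆ᵇ R (möbius g) ⟩
      möbius g R ℤ.+ ∑ₛ (_⊊ᵇ R) (möbius g)                           ≡⟨ cong (ℤ._+ ∑ₛ (_⊊ᵇ R) (möbius g)) (möbius-rec R) ⟩
      g R ℤ.- ∑ₛ (_⊊ᵇ R) (möbius g) ℤ.+ ∑ₛ (_⊊ᵇ R) (möbius g)        ≡⟨ cancel (g R) _ ⟩
      g R                                                            ∎
      where
      open ≡-Reasoning
      cancel : ∀ a s → a ℤ.- s ℤ.+ s ≡ a
      cancel = solve-∀

    möbius-⊈ : (K : Subset d) → (∀ S → g (S ∩ K) ≡ g S) → ∀ S → ¬ S ⊆ K → möbius g S ≡ + 0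
    möbius-⊈ K g-local S = go ∣ S ∣ S ℕ.≤-refl
      where
      go : ∀ m S → ∣ S ∣ ≤ m → ¬ S ⊆ K → möbius g S ≡ + 0
      go zero    S ∣S∣≤0 S⊈K = ⊥-elim (S⊈K (subst (λ P → P ⊆ K) (sym (∣p∣≡0⇒p≡⊥ (ℕ.n≤0⇒n≡0 ∣S∣≤0))) ⊥⊆))
      go (suc m) S ∣S∣≤m S⊈K = begin
        möbius g S                            ≡⟨ möbius-rec S ⟩
        g S ℤ.- ∑ₛ (_⊊ᵇ S) (möbius g)         ≡⟨ cong (λ s → g S ℤ.- s) (∑-cong pointwise (allSubsets d)) ⟩
        g S ℤ.- ∑ₛ (_⊆ᵇ (S ∩ K)) (möbius g)     ≡⟨ cong (λ s → g S ℤ.- s) (trans (∑-möbius (S ∩ K)) (g-local S)) ⟩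
        g S ℤ.- g S                           ≡⟨ ℤ.+-inverseʳ (g S) ⟩
        + 0                                   ∎
        where
        open ≡-Reasoning
        pointwise : ∀ T → (if T ⊊ᵇ S then möbius g T else + 0) ≡ (if T ⊆ᵇ (S ∩ K) then möbius g T else + 0)
        pointwise T with T ⊆ᵇ (S ∩ K) in T⊆S∩K | T ⊊ᵇ S in T⊂S
        ... | true  | true  = refl
        ... | false | false = refl
        ... | true  | false = case trans (sym (⊂⇒⊊ᵇ (⊆∧≢⇒⊂ (p∩q⊆p S K ∘ T⊆ᵇS∩K) T≢S))) T⊂S of λ ()
          where
          T⊆ᵇS∩K = ⊆ᵇ⇒⊆ T⊆S∩K
          T≢S : T ≢ S
          T≢S refl = S⊈K (p∩q⊆q S K ∘ T⊆ᵇS∩K)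
        ... | false | true  = go m T (smaller T⊂S ∣S∣≤m) T⊈K
          where
          T⊈K : ¬ T ⊆ K
          T⊈K T⊆K = case trans (sym T⊆S∩K) (⊆⇒⊆ᵇ (λ x∈T → x∈p∩q⁺ (proj₁ (⊊ᵇ⇒⊂ T⊂S) x∈T , T⊆K x∈T))) of λ ()

module _ (n : ℕ) {d : ℕ} (indep : Subset d → Bool) where

  open MatroidNotions n indep

  aFuel≡möbiusFuel : ∀ k S → aFuel k S ≡ möbiusFuel c k S
  aFuel≡möbiusFuel zero    S = refl
  aFuel≡möbiusFuel (suc k) S =
    cong (λ s → c S ℤ.- s) (∑-cong (aFuel≡möbiusFuel k) (strictSubsets S))

-- Elementary split matroids

module SplitMatroid (d n q : ℕ) (H : Fin q → Subset d) (r : Fin q → ℕ)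
  (overlap≤ : ∀ i j → i ≢ j → ∣ H i ∩ H j ∣ + n ≤ r i + r j)
  (r<n : ∀ i → r i < n) (r<∣H∣ : ∀ i → r i < ∣ H i ∣) where

  indep : Subset d → Bool
  indep = splitIndep n H r

  open MatroidNotions n indep

  record Independent (X : Subset d) : Set where
    constructor independent
    field
      size≤n : ∣ X ∣ ≤ n
      ∩H≤r   : ∀ i → ∣ X ∩ H i ∣ ≤ r i
  open Independent

  indep⇒ : (X : Subset d) → indep X ≡ true → Independent X
  indep⇒ X iX with ∧-true⇒ iX
  ... | ∣X∣≤ᵇn , all≤ᵇ = independent (yes⇒ (∣ X ∣ ℕ.≤? n) ∣X∣≤ᵇn) λ i → yes⇒ (∣ X ∩ H i ∣ ℕ.≤? r i) (all-allFin⇒ _ all≤ᵇ i)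

  ⇒indep : {X : Subset d} → Independent X → indep X ≡ true
  ⇒indep {X} (independent ∣X∣≤n ∩≤r) =
    cong₂ _∧_ (⇒yes (∣ X ∣ ℕ.≤? n) ∣X∣≤n) (⇒all-allFin _ λ i → ⇒yes (∣ X ∩ H i ∣ ℕ.≤? r i) (∩≤r i))

  dependent⇒overfull : {X : Subset d} → indep X ≢ true → ∣ X ∣ ≤ n → ∃ λ i → r i < ∣ X ∩ H i ∣
  dependent⇒overfull {X} dep ∣X∣≤n with Fin.¬∀⟶∃¬ q (λ i → ∣ X ∩ H i ∣ ≤ r i) (λ i → ∣ X ∩ H i ∣ ℕ.≤? r i)
                                          (λ ∩≤r → dep (⇒indep (independent {X} ∣X∣≤n ∩≤r)))
  ... | i , ∩≰r = i , ℕ.≰⇒> ∩≰r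

  indep-⊥ : indep ⊥ ≡ true
  indep-⊥ = ⇒indep (independent {⊥} (subst (_≤ n) (sym (∣⊥∣≡0 d)) z≤n)
                    λ i → ℕ.≤-trans (p⊆q⇒∣p∣≤∣q∣ (p∩q⊆p ⊥ (H i))) (subst (_≤ r i) (sym (∣⊥∣≡0 d)) z≤n))

  open Rank n indep indep-⊥

  ∣Hi∩Hj∣<rj : ∀ {i j} → i ≢ j → ∣ H i ∩ H j ∣ < r j
  ∣Hi∩Hj∣<rj {i} {j} i≢j = ℕ.+-cancelˡ-< (r i) _ _ (begin-strict
    r i + ∣ H i ∩ H j ∣  <⟨ ℕ.+-monoˡ-< _ (r<n i) ⟩
    n + ∣ H i ∩ H j ∣    ≡⟨ ℕ.+-comm n _ ⟩
    ∣ H i ∩ H j ∣ + n    ≤⟨ overlap≤ i j i≢j ⟩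
    r i + r j            ∎)
    where open ℕ.≤-Reasoning

  H-injective : ∀ {i j} → H i ≡ H j → i ≡ j
  H-injective {i} {j} Hi≡Hj with i Fin.≟ j
  ... | yes i≡j = i≡j
  ... | no  i≢j = ⊥-elim (ℕ.<⇒≱ (∣Hi∩Hj∣<rj i≢j) rj≤∣Hi∩Hj∣)
    where
    rj≤∣Hi∩Hj∣ : r j ≤ ∣ H i ∩ H j ∣
    rj≤∣Hi∩Hj∣ = subst (λ X → r j ≤ ∣ X ∣) (trans (sym (∩-idem (H j))) (cong (_∩ H j) (sym Hi≡Hj))) (ℕ.<⇒≤ (r<∣H∣ j))

  ⊆H⇒Independent : ∀ {X i} → X ⊆ H i → ∣ X ∣ ≤ r i → Independent X
  ⊆H⇒Independent {X} {i} X⊆Hi ∣X∣≤ri = independent {X} (ℕ.≤-trans ∣X∣≤ri (ℕ.<⇒≤ (r<n i))) bound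
    where
    bound : ∀ j → ∣ X ∩ H j ∣ ≤ r j
    bound j with i Fin.≟ j
    ... | yes refl = ℕ.≤-trans (p⊆q⇒∣p∣≤∣q∣ (p∩q⊆p X (H i))) ∣X∣≤ri
    ... | no  i≢j  = ℕ.≤-trans (p⊆q⇒∣p∣≤∣q∣ (∩-monoˡ-⊆ (H j) X⊆Hi))
                               (ℕ.<⇒≤ (∣Hi∩Hj∣<rj i≢j))

  rank-⊆H : ∀ {S i} → S ⊆ H i → r i ≤ ∣ S ∣ → rank S ≡ r i
  rank-⊆H {S} {i} S⊆Hi ri≤∣S∣ with ⊆-ofSize S ri≤∣S∣
  ... | Y , Y⊆S , ∣Y∣≡ri = ℕ.≤-antisym (rank-≤ S bound) (subst (_≤ rank S) ∣Y∣≡ri (≤-rank (⇒indep Y-independent) Y⊆S))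
    where
    bound : ∀ {X} → X ⊆ S → indep X ≡ true → ∣ X ∣ ≤ r i
    bound {X} X⊆S iX = subst (_≤ r i) (cong ∣_∣ (⊆⇒∩≡ (⊆-trans X⊆S S⊆Hi))) (∩H≤r (indep⇒ X iX) i)
    Y-independent : Independent Y
    Y-independent = ⊆H⇒Independent (⊆-trans Y⊆S S⊆Hi) (ℕ.≤-reflexive ∣Y∣≡ri)

  circuit-parts : {C : Subset d} → isCircuit C ≡ true → indep C ≢ true × (∀ {x} → x ∈ C → indep (C - x) ≡ true)
  circuit-parts {C} circ with ∧-true⇒ circ
  ... | dependent , minimal =
    (λ iC → case trans (sym dependent) (cong not iC) of λ ()) ,
    λ {x} x∈C → subst (λ b → (not b ∨ indep (C - x)) ≡ true) (∈⇒lookup x∈C) (all-allFin⇒ _ minimal x)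

  circuit⇒ : {C : Subset d} → isCircuit C ≡ true → ∣ C ∣ ≤ n → ∃ λ i → C ⊆ H i × ∣ C ∣ ≡ suc (r i)
  circuit⇒ {C} circ ∣C∣≤n with circuit-parts {C} circ
  ... | dependent , minimal with dependent⇒overfull {C} dependent ∣C∣≤n
  ... | i , ri<∣C∩Hi∣ = i , C⊆Hi , ℕ.≤-antisym upper lower
    where
    lower : suc (r i) ≤ ∣ C ∣
    lower = ℕ.≤-trans ri<∣C∩Hi∣ (p⊆q⇒∣p∣≤∣q∣ (p∩q⊆p C (H i)))
    shrunk : ∀ {x} → x ∈ C → ∣ (C - x) ∩ H i ∣ ≤ r i
    shrunk {x} x∈C = ∩H≤r (indep⇒ (C - x) (minimal x∈C)) i
    C⊆Hi : C ⊆ H i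
    C⊆Hi {x} x∈C with x ∈? H i
    ... | yes x∈Hi = x∈Hi
    ... | no  x∉Hi = ⊥-elim (ℕ.<⇒≱ ri<∣C∩Hi∣ (ℕ.≤-trans (p⊆q⇒∣p∣≤∣q∣ C∩Hi⊆C-x) (shrunk x∈C)))
      where
      C∩Hi⊆C-x : C ∩ H i ⊆ (C - x) ∩ H i
      C∩Hi⊆C-x y∈ with x∈p∩q⁻ C (H i) y∈
      ... | y∈C , y∈Hi = x∈p∩q⁺ (x∈p∧x≢y⇒x∈p-y y∈C (λ { refl → x∉Hi y∈Hi }) , y∈Hi)
    upper : ∣ C ∣ ≤ suc (r i)
    upper with 1≤∣p∣⇒nonempty (ℕ.≤-trans (s≤s z≤n) lower)
    ... | x , x∈C = subst (_≤ suc (r i)) (1+∣p-x∣≡∣p∣ x∈C)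
                      (s≤s (subst (_≤ r i) (cong ∣_∣ (⊆⇒∩≡ (⊆-trans (p─q⊆p C ⁅ x ⁆) C⊆Hi))) (shrunk x∈C)))

  ⇒circuit : ∀ {C i} → C ⊆ H i → ∣ C ∣ ≡ suc (r i) → isCircuit C ≡ true
  ⇒circuit {C} {i} C⊆Hi ∣C∣≡1+ri = cong₂ _∧_ dependent (⇒all-allFin _ minimal)
    where
    dependent : not (indep C) ≡ true
    dependent with indep C in iC
    ... | false = refl
    ... | true  = ⊥-elim (ℕ.<-irrefl refl (ℕ.≤-trans (ℕ.≤-reflexive (sym ∣C∣≡1+ri))
                    (subst (_≤ r i) (cong ∣_∣ (⊆⇒∩≡ C⊆Hi)) (∩H≤r (indep⇒ C iC) i))))
    minimal : ∀ x → (not (lookup C x) ∨ indep (C - x)) ≡ true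
    minimal x with lookup C x in Cx
    ... | false = refl
    ... | true  = ⇒indep (⊆H⇒Independent (⊆-trans (p─q⊆p C ⁅ x ⁆) C⊆Hi)
                    (ℕ.≤-reflexive (ℕ.suc-injective (trans (1+∣p-x∣≡∣p∣ (lookup⇒∈ {p = C} Cx)) ∣C∣≡1+ri))))

  -- This is what makes H i a flat.
  extend-Independent : ∀ {X i x} → X ⊆ H i → ∣ X ∣ ≤ r i → x ∉ H i → Independent (X ∪ ⁅ x ⁆)
  extend-Independent {X} {i} {x} X⊆Hi ∣X∣≤ri x∉Hi =
    independent {X ∪ ⁅ x ⁆} (ℕ.≤-trans (∣p∪⁅x⁆∣≤1+∣p∣ X x) (ℕ.≤-trans (s≤s ∣X∣≤ri) (r<n i))) bound
    where
    bound : ∀ j → ∣ (X ∪ ⁅ x ⁆) ∩ H j ∣ ≤ r j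
    bound j with i Fin.≟ j
    ... | yes refl = ℕ.≤-trans (p⊆q⇒∣p∣≤∣q∣ (p∩q⊆p X (H i) ∘ x∉q⇒[p∪⁅x⁆]∩q⊆p∩q X (H i) x∉Hi)) ∣X∣≤ri
    ... | no  i≢j  = begin
      ∣ (X ∪ ⁅ x ⁆) ∩ H j ∣     ≤⟨ p⊆q⇒∣p∣≤∣q∣ ([p∪⁅x⁆]∩q⊆[p∩q]∪⁅x⁆ X (H j) x) ⟩
      ∣ (X ∩ H j) ∪ ⁅ x ⁆ ∣     ≤⟨ ∣p∪⁅x⁆∣≤1+∣p∣ (X ∩ H j) x ⟩
      suc ∣ X ∩ H j ∣           ≤⟨ s≤s (p⊆q⇒∣p∣≤∣q∣ (∩-monoˡ-⊆ (H j) X⊆Hi)) ⟩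
      suc ∣ H i ∩ H j ∣         ≤⟨ ∣Hi∩Hj∣<rj i≢j ⟩
      r j                       ∎
      where open ℕ.≤-Reasoning

  cl-circuit : ∀ {C i} → C ⊆ H i → ∣ C ∣ ≡ suc (r i) → cl C ≡ H i
  cl-circuit {C} {i} C⊆Hi ∣C∣≡1+ri = ⊆-antisym cl⊆Hi Hi⊆cl
    where
    rankC : rank C ≡ r i
    rankC = rank-⊆H C⊆Hi (subst (r i ≤_) (sym ∣C∣≡1+ri) (ℕ.n≤1+n _))
    Hi⊆cl : H i ⊆ cl C
    Hi⊆cl {x} x∈Hi = ∈-tabulate⁺ (⇒yes (_ ℕ.≟ _) (trans (rank-⊆H (p∪⁅x⁆⊆q C⊆Hi x∈Hi) ri≤) (sym rankC)))
      where
      ri≤ : r i ≤ ∣ C ∪ ⁅ x ⁆ ∣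
      ri≤ = ℕ.≤-trans (subst (r i ≤_) (sym ∣C∣≡1+ri) (ℕ.n≤1+n _)) (p⊆q⇒∣p∣≤∣q∣ (p⊆p∪q {p = C} ⁅ x ⁆))
    cl⊆Hi : cl C ⊆ H i
    cl⊆Hi {x} x∈cl with x ∈? H i
    ... | yes x∈Hi = x∈Hi
    ... | no  x∉Hi with 1≤∣p∣⇒nonempty {p = C} (subst (1 ≤_) (sym ∣C∣≡1+ri) (s≤s z≤n))
    ...   | c , c∈C = ⊥-elim (ℕ.<-irrefl refl (begin-strict
            r i                      <⟨ ℕ.n<1+n _ ⟩
            suc (r i)                ≡⟨ trans (∣p∪⁅x⁆∣≡1+∣p∣ (x∉Hi ∘ C-c⊆Hi)) (cong suc ∣C-c∣≡ri) ⟨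
            ∣ (C - c) ∪ ⁅ x ⁆ ∣      ≤⟨ ≤-rank (⇒indep (extend-Independent C-c⊆Hi (ℕ.≤-reflexive ∣C-c∣≡ri) x∉Hi))
                                               (p∪⁅x⁆⊆q (p⊆p∪q ⁅ x ⁆ ∘ p─q⊆p C ⁅ c ⁆) (q⊆p∪q C ⁅ x ⁆ (x∈⁅x⁆ x))) ⟩
            rank (C ∪ ⁅ x ⁆)         ≡⟨ yes⇒ (_ ℕ.≟ _) (∈-tabulate⁻ x∈cl) ⟩
            rank C                   ≡⟨ rankC ⟩
            r i                      ∎))
      where
      open ℕ.≤-Reasoning
      C-c⊆Hi : C - c ⊆ H i
      C-c⊆Hi = ⊆-trans (p─q⊆p C ⁅ c ⁆) C⊆Hi
      ∣C-c∣≡ri : ∣ C - c ∣ ≡ r i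
      ∣C-c∣≡ri = ℕ.suc-injective (trans (1+∣p-x∣≡∣p∣ c∈C) ∣C∣≡1+ri)

  inClass⇒ : ∀ {F C} → inClass F C ≡ true → ∃ λ i → C ⊆ H i × ∣ C ∣ ≡ suc (r i) × F ≡ H i
  inClass⇒ {F} {C} e = closure-is-H (circuit⇒ {C} circ (yes⇒ (∣ C ∣ ℕ.≤? n) ∣C∣≤ᵇn))
    where
    circ : isCircuit C ≡ true
    circ = proj₁ (∧-true⇒ {isCircuit C} e)
    ∣C∣≤ᵇn : (∣ C ∣ ≤ᵇ n) ≡ true
    ∣C∣≤ᵇn = proj₁ (∧-true⇒ {∣ C ∣ ≤ᵇ n} (proj₂ (∧-true⇒ {isCircuit C} e)))
    clC=F : (cl C =S F) ≡ true
    clC=F = proj₂ (∧-true⇒ {∣ C ∣ ≤ᵇ n} (proj₂ (∧-true⇒ {isCircuit C} e)))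
    closure-is-H : (∃ λ i → C ⊆ H i × ∣ C ∣ ≡ suc (r i)) → ∃ λ i → C ⊆ H i × ∣ C ∣ ≡ suc (r i) × F ≡ H i
    closure-is-H (i , C⊆Hi , ∣C∣≡1+ri) = i , C⊆Hi , ∣C∣≡1+ri , trans (sym (=S⇒≡ clC=F)) (cl-circuit C⊆Hi ∣C∣≡1+ri)

  ⇒inClass : ∀ {C i} → C ⊆ H i → ∣ C ∣ ≡ suc (r i) → inClass (H i) C ≡ true
  ⇒inClass {C} {i} C⊆Hi ∣C∣≡1+ri = cong₂ _∧_ (⇒circuit C⊆Hi ∣C∣≡1+ri)
    (cong₂ _∧_ (⇒yes (∣ C ∣ ℕ.≤? n) (subst (_≤ n) (sym ∣C∣≡1+ri) (r<n i))) (≡⇒=S (cl-circuit C⊆Hi ∣C∣≡1+ri)))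

  isSubspace : Subset d → Bool
  isSubspace F = any (inClass F) (allSubsets d)

  isSubspace⇒ : ∀ {F} → isSubspace F ≡ true → ∃ λ i → F ≡ H i
  isSubspace⇒ {F} e = witness (any⇒ (inClass F) (allSubsets d) e)
    where
    witness : (∃ λ C → C ∈ˡ allSubsets d × inClass F C ≡ true) → ∃ λ i → F ≡ H i
    witness (C , _ , inCl) = Data.Product.map₂ (proj₂ ∘ proj₂) (inClass⇒ {F} {C} inCl)

  isSubspace-H : ∀ i → isSubspace (H i) ≡ true
  isSubspace-H i with ⊆-ofSize (H i) (r<∣H∣ i)
  ... | C , C⊆Hi , ∣C∣≡1+ri = ⇒any (inClass (H i)) (∈-allSubsets C) (⇒inClass C⊆Hi ∣C∣≡1+ri)

  points-H : ∀ i → points (H i) ≡ H i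
  points-H i = ⊆-antisym points⊆Hi Hi⊆points
    where
    points⊆Hi : points (H i) ⊆ H i
    points⊆Hi {x} x∈ = via-circuit (any⇒ _ (allSubsets d) (∈-tabulate⁻ x∈))
      where
      via-circuit : (∃ λ C → C ∈ˡ allSubsets d × (inClass (H i) C ∧ lookup C x) ≡ true) → x ∈ H i
      via-circuit (C , _ , e) = let inCl , Cx = ∧-true⇒ {inClass (H i) C} e
                                    j , C⊆Hj , _ , Hi≡Hj = inClass⇒ {H i} {C} inCl
                                in subst (x ∈_) (sym Hi≡Hj) (C⊆Hj (lookup⇒∈ {p = C} Cx))
    Hi⊆points : H i ⊆ points (H i)
    Hi⊆points {x} x∈Hi with ⊆-ofSize-∋ x∈Hi (r<∣H∣ i)
    ... | C , C⊆Hi , x∈C , ∣C∣≡1+ri =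
      ∈-tabulate⁺ (⇒any (λ C → inClass (H i) C ∧ lookup C x) (∈-allSubsets C)
                         (cong₂ _∧_ (⇒inClass C⊆Hi ∣C∣≡1+ri) (∈⇒lookup x∈C)))

  rank-H : ∀ i → rank (H i) ≡ r i
  rank-H i = rank-⊆H ⊆-refl (ℕ.<⇒≤ (r<∣H∣ i))

  ∑-subspaces : (f : Subset d → ℤ) → ∑ f subspaceClosures ≡ ∑ (λ i → f (H i)) (allFin q)
  ∑-subspaces f = begin
    ∑ f subspaceClosures                                                         ≡⟨ ∑-filter isSubspace f (allSubsets d) ⟩
    ∑ (λ F → if isSubspace F then f F else + 0) (allSubsets d)                   ≡⟨ ∑-cong pointwise (allSubsets d) ⟩
    ∑ (λ F → ∑ (λ i → if F =S H i then f (H i) else + 0) (allFin q)) (allSubsets d) ≡⟨ ∑-swap _ (allSubsets d) (allFin q) ⟩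
    ∑ (λ i → ∑ₛ (_=S H i) (λ _ → f (H i))) (allFin q)                            ≡⟨ ∑-cong (λ i → ∑ₛ-=S (H i) _) (allFin q) ⟩
    ∑ (λ i → f (H i)) (allFin q)                                                 ∎
    where
    open ≡-Reasoning
    at-H : ∀ k → f (H k) ≡ ∑ (λ i → if H k =S H i then f (H i) else + 0) (allFin q)
    at-H k = sym (trans (∑-delta (allFin q) (Unique.allFin⁺ q) (∈-allFin k) off-k)
                        (cong (λ b → if b then f (H k) else + 0) (≡⇒=S {p = H k} refl)))
      where
      off-k : ∀ i → i ≢ k → (if H k =S H i then f (H i) else + 0) ≡ + 0
      off-k i i≢k rewrite ≢⇒=S (i≢k ∘ sym ∘ H-injective) = refl
    pointwise : ∀ F → (if isSubspace F then f F else + 0) ≡ ∑ (λ i → if F =S H i then f (H i) else + 0) (allFin q)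
    pointwise F with isSubspace F in sub
    ... | true  = let k , F≡Hk = isSubspace⇒ {F} sub
                  in subst (λ G → f G ≡ ∑ (λ i → if G =S H i then f (H i) else + 0) (allFin q)) (sym F≡Hk) (at-H k)
    ... | false = sym (∑-vanishes (allFin q) (All.universal none _))
      where
      none : ∀ i → (if F =S H i then f (H i) else + 0) ≡ + 0
      none i with F =S H i in F=Hi
      ... | false = refl
      ... | true  = case trans (sym sub) (subst (λ G → isSubspace G ≡ true) (sym (=S⇒≡ F=Hi)) (isSubspace-H i)) of λ ()

  naiveDim≡ : naiveDim ≡ + (n * d) ℤ.- ∑ (λ i → (+ ∣ H i ∣ ℤ.- + r i) ℤ.* (+ n ℤ.- + r i)) (allFin q)
  naiveDim≡ = cong (λ s → + (n * d) ℤ.- s) (trans (∑-subspaces _) (∑-cong subspace-term (allFin q)))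
    where
    subspace-term : ∀ i → (+ ∣ points (H i) ∣ ℤ.- + rank (H i)) ℤ.* (+ n ℤ.- + rank (H i))
                        ≡ (+ ∣ H i ∣ ℤ.- + r i) ℤ.* (+ n ℤ.- + r i)
    subspace-term i = cong₂ (λ P k → (+ ∣ P ∣ ℤ.- + k) ℤ.* (+ n ℤ.- + k)) (points-H i) (rank-H i)

  excess : Fin q → Subset d → ℤ
  excess i S = + (∣ S ∩ H i ∣ ∸ r i)

  module MaximalIndependent {S X : Subset d} (X⊆S : X ⊆ S) (iX : indep X ≡ true) (∣X∣≡rank : ∣ X ∣ ≡ rank S)
                            (rank<n : rank S < n) where

    Tight : Fin q → Set
    Tight k = ∣ X ∩ H k ∣ ≡ r k

    X∩H≤r : ∀ k → ∣ X ∩ H k ∣ ≤ r k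
    X∩H≤r = ∩H≤r (indep⇒ X iX)

    -- X ∪ {z} has more elements than rank S, so it is dependent, yet it has at most n elements.
    tight-through : ∀ {z} → z ∈ S → z ∉ X → ∃ λ k → z ∈ H k × Tight k
    tight-through {z} z∈S z∉X = tighten (dependent⇒overfull {X ∪ ⁅ z ⁆} dependent (subst (_≤ n) (sym ∣X∪z∣) ∣X∣<n))
      where
      ∣X∪z∣ : ∣ X ∪ ⁅ z ⁆ ∣ ≡ suc ∣ X ∣
      ∣X∪z∣ = ∣p∪⁅x⁆∣≡1+∣p∣ z∉X
      ∣X∣<n : ∣ X ∣ < n
      ∣X∣<n = subst (_< n) (sym ∣X∣≡rank) rank<n
      dependent : indep (X ∪ ⁅ z ⁆) ≢ true
      dependent iX∪z = ℕ.<-irrefl refl (begin-strict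
        rank S           ≡⟨ ∣X∣≡rank ⟨
        ∣ X ∣            <⟨ ℕ.n<1+n _ ⟩
        suc ∣ X ∣        ≡⟨ ∣X∪z∣ ⟨
        ∣ X ∪ ⁅ z ⁆ ∣    ≤⟨ ≤-rank iX∪z (p∪⁅x⁆⊆q X⊆S z∈S) ⟩
        rank S           ∎)
        where open ℕ.≤-Reasoning
      tighten : (∃ λ k → r k < ∣ (X ∪ ⁅ z ⁆) ∩ H k ∣) → ∃ λ k → z ∈ H k × Tight k
      tighten (k , overfull) = k , z∈Hk , ℕ.≤-antisym (X∩H≤r k) (ℕ.≤-pred (ℕ.≤-trans overfull grow))
        where
        grow : ∣ (X ∪ ⁅ z ⁆) ∩ H k ∣ ≤ suc ∣ X ∩ H k ∣
        grow = ℕ.≤-trans (p⊆q⇒∣p∣≤∣q∣ ([p∪⁅x⁆]∩q⊆[p∩q]∪⁅x⁆ X (H k) z)) (∣p∪⁅x⁆∣≤1+∣p∣ (X ∩ H k) z)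
        z∈Hk : z ∈ H k
        z∈Hk with z ∈? H k
        ... | yes z∈Hk = z∈Hk
        ... | no  z∉Hk = ⊥-elim (ℕ.<⇒≱ overfull
                           (ℕ.≤-trans (p⊆q⇒∣p∣≤∣q∣ (x∉q⇒[p∪⁅x⁆]∩q⊆p∩q X (H k) z∉Hk)) (X∩H≤r k)))

    beyond-tight : ∀ {A k j} → A ─ X ⊆ H k → Tight k → k ≢ j → ∣ A ∩ H j ∣ < r j
    beyond-tight {A} {k} {j} A─X⊆Hk tight k≢j = ℕ.+-cancelˡ-< (r k) _ _ (begin-strict
      r k + ∣ A ∩ H j ∣                 ≡⟨ cong (_+ ∣ A ∩ H j ∣) tight ⟨
      ∣ X ∩ H k ∣ + ∣ A ∩ H j ∣         ≡⟨ ℕ.+-comm ∣ X ∩ H k ∣ _ ⟩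
      ∣ A ∩ H j ∣ + ∣ X ∩ H k ∣         ≤⟨ ∣p∣+∣q∣≤∣u∣+∣v∣ (A ∩ H j) (X ∩ H k) X (H k ∩ H j) ∩⊆ ∪⊆ ⟩
      ∣ X ∣ + ∣ H k ∩ H j ∣             <⟨ ℕ.+-monoˡ-< _ (subst (_< n) (sym ∣X∣≡rank) rank<n) ⟩
      n + ∣ H k ∩ H j ∣                 ≡⟨ ℕ.+-comm n _ ⟩
      ∣ H k ∩ H j ∣ + n                 ≤⟨ overlap≤ k j k≢j ⟩
      r k + r j                         ∎)
      where
      open ℕ.≤-Reasoning
      ∩⊆ : (A ∩ H j) ∩ (X ∩ H k) ⊆ X ∩ (H k ∩ H j)
      ∩⊆ y∈ = let y∈A∩Hj , y∈X∩Hk = x∈p∩q⁻ (A ∩ H j) (X ∩ H k) y∈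
                  _ , y∈Hj = x∈p∩q⁻ A (H j) y∈A∩Hj
                  y∈X , y∈Hk = x∈p∩q⁻ X (H k) y∈X∩Hk
              in x∈p∩q⁺ (y∈X , x∈p∩q⁺ (y∈Hk , y∈Hj))
      ∪⊆ : (A ∩ H j) ∪ (X ∩ H k) ⊆ X ∪ (H k ∩ H j)
      ∪⊆ {y} y∈ with x∈p∪q⁻ (A ∩ H j) (X ∩ H k) y∈
      ... | inj₂ y∈X∩Hk = x∈p∪q⁺ (inj₁ (proj₁ (x∈p∩q⁻ X (H k) y∈X∩Hk)))
      ... | inj₁ y∈A∩Hj with y ∈? X
      ...   | yes y∈X = x∈p∪q⁺ (inj₁ y∈X)
      ...   | no  y∉X = let y∈A , y∈Hj = x∈p∩q⁻ A (H j) y∈A∩Hj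
                        in x∈p∪q⁺ (inj₂ (x∈p∩q⁺ (A─X⊆Hk (x∈p∧x∉q⇒x∈p─q y∈A y∉X) , y∈Hj)))

    tight-unique : ∀ {k l} → Tight k → Tight l → k ≡ l
    tight-unique {k} {l} tk tl with k Fin.≟ l
    ... | yes k≡l = k≡l
    ... | no  k≢l = ⊥-elim (ℕ.<-irrefl tl (beyond-tight X─X⊆Hk tk k≢l))
      where
      X─X⊆Hk : X ─ X ⊆ H k
      X─X⊆Hk y∈ = ⊥-elim (x∈p─q⇒x∉q y∈ (p─q⊆p X X y∈))

    c-decomposition : c S ≡ ∑ (λ i → excess i S) (allFin q)
    c-decomposition = by-cases (S ⊆? X)
      where
      single-excess : ∀ k → Tight k → c S ≡ ∑ (λ i → excess i S) (allFin q)
      single-excess k tk = begin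
        + ∣ S ∣ ℤ.- + rank S                             ≡⟨ cong (λ m → + m ℤ.- + rank S) ∣S∣≡ ⟩
        + ((∣ S ∩ H k ∣ ∸ r k) + rank S) ℤ.- + rank S    ≡⟨ +[m+n]-+n≡+m _ (rank S) ⟩
        excess k S                                       ≡⟨ ∑-delta (allFin q) (Unique.allFin⁺ q) (∈-allFin k) off-k ⟨
        ∑ (λ i → excess i S) (allFin q)                  ∎
        where
        open ≡-Reasoning
        S─X⊆Hk : S ─ X ⊆ H k
        S─X⊆Hk y∈ = let l , y∈Hl , tl = tight-through (p─q⊆p S X y∈) (x∈p─q⇒x∉q y∈)
                    in subst (λ i → _ ∈ H i) (sym (tight-unique tk tl)) y∈Hl
        S─Hk⊆X─Hk : S ─ H k ⊆ X ─ H k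
        S─Hk⊆X─Hk {y} y∈ with y ∈? X
        ... | yes y∈X = x∈p∧x∉q⇒x∈p─q y∈X (x∈p─q⇒x∉q y∈)
        ... | no  y∉X = ⊥-elim (x∈p─q⇒x∉q y∈ (S─X⊆Hk (x∈p∧x∉q⇒x∈p─q (p─q⊆p S (H k) y∈) y∉X)))
        rank-split : rank S ≡ r k + ∣ S ─ H k ∣
        rank-split = begin
          rank S                        ≡⟨ ∣X∣≡rank ⟨
          ∣ X ∣                         ≡⟨ ∣p∣≡∣p∩q∣+∣p─q∣ X (H k) ⟩
          ∣ X ∩ H k ∣ + ∣ X ─ H k ∣     ≡⟨ cong₂ _+_ tk (cong ∣_∣ (⊆-antisym (─-monoˡ-⊆ (H k) X⊆S) S─Hk⊆X─Hk)) ⟩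
          r k + ∣ S ─ H k ∣             ∎
        ∣S∣≡ : ∣ S ∣ ≡ (∣ S ∩ H k ∣ ∸ r k) + rank S
        ∣S∣≡ = begin
          ∣ S ∣                                      ≡⟨ ∣p∣≡∣p∩q∣+∣p─q∣ S (H k) ⟩
          ∣ S ∩ H k ∣ + ∣ S ─ H k ∣                  ≡⟨ cong (_+ ∣ S ─ H k ∣) (ℕ.m∸n+n≡m rk≤) ⟨
          (∣ S ∩ H k ∣ ∸ r k) + r k + ∣ S ─ H k ∣    ≡⟨ ℕ.+-assoc (∣ S ∩ H k ∣ ∸ r k) _ _ ⟩
          (∣ S ∩ H k ∣ ∸ r k) + (r k + ∣ S ─ H k ∣)  ≡⟨ cong (λ m → (∣ S ∩ H k ∣ ∸ r k) + m) rank-split ⟨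
          (∣ S ∩ H k ∣ ∸ r k) + rank S               ∎
          where
          rk≤ : r k ≤ ∣ S ∩ H k ∣
          rk≤ = subst (_≤ ∣ S ∩ H k ∣) tk (p⊆q⇒∣p∣≤∣q∣ (∩-monoˡ-⊆ (H k) X⊆S))
        off-k : ∀ j → j ≢ k → excess j S ≡ + 0
        off-k j j≢k = cong +_ (ℕ.m≤n⇒m∸n≡0 (ℕ.<⇒≤ (beyond-tight S─X⊆Hk tk (j≢k ∘ sym))))
      by-cases : Dec (S ⊆ X) → c S ≡ ∑ (λ i → excess i S) (allFin q)
      by-cases (yes S⊆X) = begin
        + ∣ S ∣ ℤ.- + rank S               ≡⟨ cong (λ k → + ∣ S ∣ ℤ.- + k) (trans (sym ∣X∣≡rank) (cong ∣_∣ X≡S)) ⟩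
        + ∣ S ∣ ℤ.- + ∣ S ∣                ≡⟨ ℤ.+-inverseʳ (+ ∣ S ∣) ⟩
        + 0                                ≡⟨ ∑-vanishes (allFin q) (All.universal no-excess _) ⟨
        ∑ (λ i → excess i S) (allFin q)    ∎
        where
        open ≡-Reasoning
        X≡S : X ≡ S
        X≡S = ⊆-antisym X⊆S S⊆X
        no-excess : ∀ i → excess i S ≡ + 0
        no-excess i = cong +_ (ℕ.m≤n⇒m∸n≡0 (subst (λ Y → ∣ Y ∩ H i ∣ ≤ r i) X≡S (X∩H≤r i)))
      by-cases (no S⊈X) = let z , z∈S , z∉X = ⊈⇒∃∉ S⊈X
                              k , _ , tk = tight-through z∈S z∉X
                          in single-excess k tk

  c-decomposition : ∀ S → rank S < n → c S ≡ ∑ (λ i → excess i S) (allFin q)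
  c-decomposition S rank<n = let X , X⊆S , iX , ∣X∣≡rank = rank-witness S
                             in MaximalIndependent.c-decomposition X⊆S iX ∣X∣≡rank rank<n

  remainder : Subset d → ℤ
  remainder S = c S ℤ.- ∑ (λ i → excess i S) (allFin q)

  a-split : ∀ S → a S ≡ ∑ (λ i → möbius (excess i) S) (allFin q) ℤ.+ möbius remainder S
  a-split S = begin
    aFuel (∣ S ∣) S
      ≡⟨ aFuel≡möbiusFuel n indep (∣ S ∣) S ⟩
    möbiusFuel c (∣ S ∣) S
      ≡⟨ möbiusFuel-cong (λ T → split (c T) (∑ (λ i → excess i T) (allFin q))) (∣ S ∣) S ⟩
    möbiusFuel (λ T → ∑ (λ i → excess i T) (allFin q) ℤ.+ remainder T) (∣ S ∣) S
      ≡⟨ möbiusFuel-+ _ remainder (∣ S ∣) S ⟩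
    möbiusFuel (λ T → ∑ (λ i → excess i T) (allFin q)) (∣ S ∣) S ℤ.+ möbius remainder S
      ≡⟨ cong (ℤ._+ möbius remainder S) (möbiusFuel-∑ excess (allFin q) (∣ S ∣) S) ⟩
    ∑ (λ i → möbius (excess i) S) (allFin q) ℤ.+ möbius remainder S ∎
    where
    open ≡-Reasoning
    split : ∀ x y → x ≡ y ℤ.+ (x ℤ.- y)
    split = solve-∀

  rank≤n : ∀ S → rank S ≤ n
  rank≤n S = rank-≤ S (λ {X} _ iX → size≤n (indep⇒ X iX))

  weight : Subset d → ℤ
  weight S = + n ℤ.- + rank S

  weight*möbius-remainder : ∀ S → weight S ℤ.* möbius remainder S ≡ + 0
  weight*möbius-remainder S with rank S ℕ.<? n
  ... | yes rank<n = trans (cong (ℤ._*_ (weight S)) remainder-vanishes) (ℤ.*-zeroʳ (weight S))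
    where
    remainder-vanishes : möbius remainder S ≡ + 0
    remainder-vanishes = möbiusFuel-vanishes remainder (λ T → rank T < n) (λ P⊆Q → ℕ.≤-<-trans (rank-mono P⊆Q))
                           (λ T rank<n → trans (cong (λ s → c T ℤ.- s) (sym (c-decomposition T rank<n)))
                                               (ℤ.+-inverseʳ (c T)))
                           ∣ S ∣ S rank<n
  ... | no  rank≮n = trans (cong (ℤ._* möbius remainder S) weight≡0) (ℤ.*-zeroˡ (möbius remainder S))
    where
    weight≡0 : weight S ≡ + 0
    weight≡0 = trans (cong (λ k → + n ℤ.- + k) (ℕ.≤-antisym (rank≤n S) (ℕ.≮⇒≥ rank≮n))) (ℤ.+-inverseʳ (+ n))

  excess-⊥ : ∀ i → excess i ⊥ ≡ + 0
  excess-⊥ i = cong +_ (ℕ.m≤n⇒m∸n≡0 (ℕ.≤-trans (p⊆q⇒∣p∣≤∣q∣ (p∩q⊆p ⊥ (H i))) (subst (_≤ r i) (sym (∣⊥∣≡0 d)) z≤n)))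

  excess-local : ∀ i S → excess i (S ∩ H i) ≡ excess i S
  excess-local i S = cong (λ X → + (∣ X ∣ ∸ r i)) (trans (∩-assoc S (H i) (H i)) (cong (S ∩_) (∩-idem (H i))))

  weighted-möbius-excess : ∀ i → ∑ (λ S → weight S ℤ.* möbius (excess i) S) (allSubsets d)
                                ≡ (+ n ℤ.- + r i) ℤ.* (+ ∣ H i ∣ ℤ.- + r i)
  weighted-möbius-excess i = begin
    ∑ (λ S → weight S ℤ.* μᵢ S) (allSubsets d)                        ≡⟨ ∑-cong pointwise (allSubsets d) ⟩
    ∑ (λ S → (+ n ℤ.- + r i) ℤ.* (if S ⊆ᵇ H i then μᵢ S else + 0)) (allSubsets d)
                                                                     ≡⟨ ∑-*ˡ (+ n ℤ.- + r i) _ (allSubsets d) ⟩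
    (+ n ℤ.- + r i) ℤ.* ∑ₛ (_⊆ᵇ H i) μᵢ
                                    ≡⟨ cong (ℤ._*_ (+ n ℤ.- + r i)) (Möbius.∑-möbius (excess i) (excess-⊥ i) (H i)) ⟩
    (+ n ℤ.- + r i) ℤ.* excess i (H i)                               ≡⟨ cong (ℤ._*_ (+ n ℤ.- + r i)) excess-H ⟩
    (+ n ℤ.- + r i) ℤ.* (+ ∣ H i ∣ ℤ.- + r i)                         ∎
    where
    open ≡-Reasoning
    μᵢ : Subset d → ℤ
    μᵢ = möbius (excess i)
    excess-H : excess i (H i) ≡ + ∣ H i ∣ ℤ.- + r i
    excess-H = trans (cong (λ X → + (∣ X ∣ ∸ r i)) (∩-idem (H i))) (sym (+m-+n≡+[m∸n] (ℕ.<⇒≤ (r<∣H∣ i))))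
    vanishing-term : ∀ {S x} → μᵢ S ≡ + 0 → x ≡ + 0 → weight S ℤ.* μᵢ S ≡ (+ n ℤ.- + r i) ℤ.* x
    vanishing-term {S} μS≡0 x≡0 = trans (cong (ℤ._*_ (weight S)) μS≡0)
      (trans (ℤ.*-zeroʳ (weight S)) (sym (trans (cong (ℤ._*_ (+ n ℤ.- + r i)) x≡0) (ℤ.*-zeroʳ (+ n ℤ.- + r i)))))
    pointwise : ∀ S → weight S ℤ.* μᵢ S ≡ (+ n ℤ.- + r i) ℤ.* (if S ⊆ᵇ H i then μᵢ S else + 0)
    pointwise S with S ⊆ᵇ H i in S⊆ᵇHi
    ... | false = vanishing-term {S} (Möbius.möbius-⊈ (excess i) (excess-⊥ i) (H i) (excess-local i) S
                               (λ S⊆Hi → case trans (sym (⊆⇒⊆ᵇ S⊆Hi)) S⊆ᵇHi of λ ())) refl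
    ... | true with r i ℕ.≤? ∣ S ∣
    ...   | yes ri≤∣S∣ = cong (λ k → (+ n ℤ.- + k) ℤ.* μᵢ S) (rank-⊆H {S} {i} (⊆ᵇ⇒⊆ S⊆ᵇHi) ri≤∣S∣)
    ...   | no  ri≰∣S∣ = vanishing-term {S} small-vanishes small-vanishes
      where
      small-vanishes : μᵢ S ≡ + 0
      small-vanishes = möbiusFuel-vanishes (excess i) (λ T → ∣ T ∩ H i ∣ ≤ r i)
                         (λ P⊆Q → ℕ.≤-trans (p⊆q⇒∣p∣≤∣q∣ (∩-monoˡ-⊆ (H i) P⊆Q)))
                         (λ T small → cong +_ (ℕ.m≤n⇒m∸n≡0 small))
                         ∣ S ∣ S (ℕ.≤-trans (p⊆q⇒∣p∣≤∣q∣ (p∩q⊆p S (H i))) (ℕ.<⇒≤ (ℕ.≰⇒> ri≰∣S∣)))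

  ec≡ : ec ≡ ∑ (λ i → (+ n ℤ.- + r i) ℤ.* (+ ∣ H i ∣ ℤ.- + r i)) (allFin q)
  ec≡ = begin
    ∑ (λ S → weight S ℤ.* a S) (allSubsets d)                                         ≡⟨ ∑-cong pointwise (allSubsets d) ⟩
    ∑ (λ S → ∑ (λ i → weight S ℤ.* möbius (excess i) S) (allFin q)) (allSubsets d)    ≡⟨ ∑-swap _ (allSubsets d) (allFin q) ⟩
    ∑ (λ i → ∑ (λ S → weight S ℤ.* möbius (excess i) S) (allSubsets d)) (allFin q)    ≡⟨ ∑-cong weighted-möbius-excess (allFin q) ⟩
    ∑ (λ i → (+ n ℤ.- + r i) ℤ.* (+ ∣ H i ∣ ℤ.- + r i)) (allFin q)                     ∎
    where
    open ≡-Reasoning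
    pointwise : ∀ S → weight S ℤ.* a S ≡ ∑ (λ i → weight S ℤ.* möbius (excess i) S) (allFin q)
    pointwise S = begin
      weight S ℤ.* a S
        ≡⟨ cong (ℤ._*_ (weight S)) (a-split S) ⟩
      weight S ℤ.* (∑ (λ i → möbius (excess i) S) (allFin q) ℤ.+ möbius remainder S)
        ≡⟨ ℤ.*-distribˡ-+ (weight S) _ _ ⟩
      weight S ℤ.* ∑ (λ i → möbius (excess i) S) (allFin q) ℤ.+ weight S ℤ.* möbius remainder S
        ≡⟨ cong (ℤ._+_ (weight S ℤ.* ∑ (λ i → möbius (excess i) S) (allFin q))) (weight*möbius-remainder S) ⟩
      weight S ℤ.* ∑ (λ i → möbius (excess i) S) (allFin q) ℤ.+ + 0
        ≡⟨ ℤ.+-identityʳ _ ⟩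
      weight S ℤ.* ∑ (λ i → möbius (excess i) S) (allFin q)
        ≡⟨ ∑-*ˡ (weight S) _ (allFin q) ⟨
      ∑ (λ i → weight S ℤ.* möbius (excess i) S) (allFin q) ∎

theorem3p11 : (d n q : ℕ) → 1 ≤ n → n ≤ d →
    (H : Fin q → Subset d) (r : Fin q → ℕ) →
    (∀ i → 1 ≤ r i) →
    (∀ i j → i ≢ j → ∣ H i ∩ H j ∣ + n ≤ r i + r j) →
    (∀ i → ∣ ∁ (H i) ∣ + r i ≥ n) →
    (∀ i → r i < n) →
    (∀ i → r i < ∣ H i ∣) →
    let open MatroidNotions n (splitIndep n H r) in
    (naiveDim ≡ + (n * d) ℤ.- ec)
    × (+ (n * d) ℤ.- ec ≡ + (n * d) ℤ.- sumℤ (map (λ i → (+ n ℤ.- + r i) ℤ.* (+ ∣ H i ∣ ℤ.- + r i)) (allFin q)))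
theorem3p11 d n q _ _ H r _ overlap≤ _ r<n r<∣H∣ =
  trans naiveDim≡ (cong (λ s → + (n * d) ℤ.- s) (trans (∑-cong factors-commute (allFin q)) (sym ec≡))) ,
  cong (λ s → + (n * d) ℤ.- s) ec≡
  where
  open SplitMatroid d n q H r overlap≤ r<n r<∣H∣
  factors-commute : ∀ i → (+ ∣ H i ∣ ℤ.- + r i) ℤ.* (+ n ℤ.- + r i) ≡ (+ n ℤ.- + r i) ℤ.* (+ ∣ H i ∣ ℤ.- + r i)
  factors-commute i = ℤ.*-comm (+ ∣ H i ∣ ℤ.- + r i) _
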